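{- For all (unrestricted) terms $M,N$ of the call-by-value $\lambda\Box$-calculus, $M=_vN$ implies $[\![M]\!]^\dagger=_n[\![N]\!]^\dagger$.
   Context: Types: $\sigma::=p\mid\sigma\supset\sigma\mid\Box\sigma$. Terms (box bodies arbitrary): $M::=c\mid x\mid\lambda x^\sigma.M\mid MM\mid\mathbf{box}_{x_1^{\sigma_1},\dots,x_n^{\sigma_n}}(M_1,\dots,M_n;M)$. The $x_i$ are bound in the body, and the free variables of a box term are those of the $M_i$. $\vec N(\lambda\vec x.M)$ abbreviates $N_1(\lambda x_1.\cdots N_n(\lambda x_n.M)\cdots)$. Call-by-name reduction $\to_n$ is the closure under term contexts of: - $(\lambda x.M)N\to M[x:=N]$; - $\lambda x.Mx\to M$ ($x\notin FV(M)$); - $\mathbf{box}_x(M;x)\to M$; - $\mathbf{box}_{\vec w,x,\vec z}(\vec P,\mathbf{box}_{\vec y}(\vec L;N),\vec Q;M)\to\mathbf{box}_{\vec w,\vec y,\vec z}(\vec P,\vec L,\vec Q;M[x:=N])$ with $|\vec w|=|\vec P|$. Call-by-value. Values: $V::=c\mid x\mid\lambda x.M\mid\mathbf{box}_{\vec x}(V_1,\dots,V_n;M)$. Simple evaluation contexts: $C::=[\,]M\mid V[\,]\mid\mathbf{box}_{\vec x}(V_1,\dots,V_k,[\,],M_1,\dots,M_m;M)$. Evaluation contexts: $E::=[\,]\mid C[E]$. $\to_v$ is the closure under term contexts of the following rules ($y$ a variable, new bound variables fresh): - $(\lambda x.x)M\to M$; - $(\lambda x.M)V\to M[x:=V]$;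 - $\lambda x.Vx\to V$ ($x\notin FV(V)$); - $C[(\lambda x.M)N]\to(\lambda x.C[M])N$; - $C[yM]\to(\lambda x.C[x])(yM)$ if $C$ is not of the form $V[\,]$; - $(\lambda x.E[yx])M\to E[yM]$ if $x\notin FV(E[y])$; - $\mathbf{box}_x(M;x)\to M$; - $\mathbf{box}_{\vec w,x,\vec z}(\vec W,\mathbf{box}_{\vec y}(\vec N;V),\vec P;M)\to\mathbf{box}_{\vec w,\vec y,\vec z}(\vec W,\vec N,\vec P;M[x:=V])$, $\vec W$ values, $|\vec w|=|\vec W|$. $=_v$ and $=_n$ are the reflexive, symmetric, transitive closures of $\to_v$ and $\to_n$. Modified CPS transformation into the call-by-name calculus, with $R$ a fixed type constant and $k,h,y_i,z_i$ fresh variables. Types: - $p^\dagger=p$; - $(\sigma\supset\tau)^\dagger=(\tau^\dagger\supset R)\supset\sigma^\dagger\supset R$; - $(\Box\sigma)^\dagger=\Box((\sigma^\dagger\supset R)\supset R)$. Terms: - $[\![x]\!]^\dagger=\lambda k.kx$, $[\![c]\!]^\dagger=\lambda k.kc$; - $[\![\lambda x.M]\!]^\dagger=\lambda k.k(\lambda k'.\lambda x.[\![M]\!]^\dagger k')$; - $[\![MN]\!]^\dagger=\lambda k.[\![M]\!]^\dagger(\lambda y.[\![N]\!]^\dagger(yk))$; - $[\![\mathbf{box}_{\vec x}(\vec N;M)]\!]^\dagger=\lambda k.[\![\vec N]\!]^\dagger(\lambda\vec y.\,k(\mathbf{box}_{\vec z}(\vec y;\lambda h.\vec z(\lambda\vec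 x.[\![M]\!]^\dagger h))))$. -}

module Defs where

open import Data.List using (List; []; _∷_; _++_; map)
open import Data.List.Relation.Unary.All as All using (All; []; _∷_)
open import Data.Product using (Σ; _×_; _,_)
open import Data.Unit using (⊤)
open import Data.Empty using (⊥)
open import Relation.Binary.PropositionalEquality using (_≡_; refl)
open import Relation.Binary.Construct.Closure.Equivalence using (EqClosure)

infixr 7 _⇒_
data Ty (A : Set) : Set where
  atom : A → Ty A
  _⇒_  : Ty A → Ty A → Ty A
  □_   : Ty A → Ty A

Ctx : Set → Set
Ctx A = List (Ty A)

-- de Bruijn variables (ze = most recently bound / first box binder)
infix 4 _∋_
data _∋_ {A : Set} : Ctx A → Ty A → Set where
  ze : ∀ {Γ σ} → (σ ∷ Γ) ∋ σ
  su : ∀ {Γ σ τ} → Γ ∋ σ → (τ ∷ Γ) ∋ σ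

Ren : {A : Set} → Ctx A → Ctx A → Set
Ren Γ Δ = ∀ {σ} → Γ ∋ σ → Δ ∋ σ

ext : ∀ {A} {Γ Δ : Ctx A} {σ} → Ren Γ Δ → Ren (σ ∷ Γ) (σ ∷ Δ)
ext ρ ze     = ze
ext ρ (su x) = su (ρ x)

injL : ∀ {A} {Δ Θ : Ctx A} {σ} → Δ ∋ σ → (Δ ++ Θ) ∋ σ
injL ze     = ze
injL (su x) = su (injL x)

raise : ∀ {A} (Δ : Ctx A) {Θ : Ctx A} {σ} → Θ ∋ σ → (Δ ++ Θ) ∋ σ
raise []      x = x
raise (_ ∷ Δ) x = su (raise Δ x)

-- The λ□-calculus with constants (constant c : Const σ has type σ),
-- intrinsically typed.  box_{x1..xn}(M1,..,Mn; M) is  box Ms M  where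
-- Ms : Args Γ [σ1,..,σn] (Mi : □σi) and M : Tm [σ1,..,σn] τ (the body
-- only has the xi free; ze refers to x1).

module Calculus {A : Set} (Const : Ty A → Set) where

  data Tm : Ctx A → Ty A → Set
  data Args (Γ : Ctx A) : Ctx A → Set

  data Tm where
    con : ∀ {Γ σ} → Const σ → Tm Γ σ
    var : ∀ {Γ σ} → Γ ∋ σ → Tm Γ σ
    lam : ∀ {Γ σ τ} → Tm (σ ∷ Γ) τ → Tm Γ (σ ⇒ τ)
    app : ∀ {Γ σ τ} → Tm Γ (σ ⇒ τ) → Tm Γ σ → Tm Γ τ
    box : ∀ {Γ Δ τ} → Args Γ Δ → Tm Δ τ → Tm Γ (□ τ)

  data Args Γ where
    []  : Args Γ []
    _∷_ : ∀ {σ Δ} → Tm Γ (□ σ) → Args Γ Δ → Args Γ (σ ∷ Δ)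

  infixr 5 _++ᵃ_
  _++ᵃ_ : ∀ {Γ Δ₁ Δ₂} → Args Γ Δ₁ → Args Γ Δ₂ → Args Γ (Δ₁ ++ Δ₂)
  []       ++ᵃ Qs = Qs
  (P ∷ Ps) ++ᵃ Qs = P ∷ (Ps ++ᵃ Qs)

  ren  : ∀ {Γ Δ σ} → Ren Γ Δ → Tm Γ σ → Tm Δ σ
  renA : ∀ {Γ Δ Θ} → Ren Γ Δ → Args Γ Θ → Args Δ Θ
  ren ρ (con c)    = con c
  ren ρ (var x)    = var (ρ x)
  ren ρ (lam M)    = lam (ren (ext ρ) M)
  ren ρ (app M N)  = app (ren ρ M) (ren ρ N)
  ren ρ (box Ns M) = box (renA ρ Ns) M
  renA ρ []       = []
  renA ρ (N ∷ Ns) = ren ρ N ∷ renA ρ Ns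

  wk : ∀ {Γ σ τ} → Tm Γ σ → Tm (τ ∷ Γ) σ
  wk = ren su

  Sub : Ctx A → Ctx A → Set
  Sub Γ Δ = ∀ {σ} → Γ ∋ σ → Tm Δ σ

  exts : ∀ {Γ Δ σ} → Sub Γ Δ → Sub (σ ∷ Γ) (σ ∷ Δ)
  exts s ze     = var ze
  exts s (su x) = wk (s x)

  sub  : ∀ {Γ Δ σ} → Sub Γ Δ → Tm Γ σ → Tm Δ σ
  subA : ∀ {Γ Δ Θ} → Sub Γ Δ → Args Γ Θ → Args Δ Θ
  sub s (con c)    = con c
  sub s (var x)    = s x
  sub s (lam M)    = lam (sub (exts s) M)
  sub s (app M N)  = app (sub s M) (sub s N)
  sub s (box Ns M) = box (subA s Ns) M
  subA s []       = []
  subA s (N ∷ Ns) = sub s N ∷ subA s Ns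

  single : ∀ {Γ σ} → Tm Γ σ → Sub (σ ∷ Γ) Γ
  single N ze     = N
  single N (su x) = var x

  _[_] : ∀ {Γ σ τ} → Tm (σ ∷ Γ) τ → Tm Γ σ → Tm Γ τ
  M [ N ] = sub (single N) M

  -- the substitution M[x := N] used in the box-box rule:
  -- from context  w⃗ , x , z⃗  to  w⃗ , y⃗ , z⃗   where N : Tm y⃗ ρ
  boxSub : ∀ (Δw : Ctx A) {ρ Δy Δz} → Tm Δy ρ → Sub (Δw ++ ρ ∷ Δz) (Δw ++ Δy ++ Δz)
  boxSub []       N ze                = ren injL N
  boxSub []       {Δy = Δy} N (su x)  = var (raise Δy x)
  boxSub (_ ∷ Δw) N ze                = var ze
  boxSub (_ ∷ Δw) N (su x)            = wk (boxSub Δw N x)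

  data Value : ∀ {Γ σ} → Tm Γ σ → Set
  data ValArgs : ∀ {Γ Δ} → Args Γ Δ → Set

  data Value where
    con : ∀ {Γ σ} {c : Const σ} → Value {Γ} (con c)
    var : ∀ {Γ σ} {x : Γ ∋ σ} → Value (var x)
    lam : ∀ {Γ σ τ} {M : Tm (σ ∷ Γ) τ} → Value (lam M)
    box : ∀ {Γ Δ τ} {Ns : Args Γ Δ} {M : Tm Δ τ} → ValArgs Ns → Value (box Ns M)

  data ValArgs where
    []  : ∀ {Γ} → ValArgs {Γ} []
    _∷_ : ∀ {Γ σ Δ} {V : Tm Γ (□ σ)} {Vs : Args Γ Δ} → Value V → ValArgs Vs → ValArgs (V ∷ Vs)

  -- simple evaluation contexts (frames), hole type σ, result type τ:
  --   [ ] M  |  V [ ]  |  box_x⃗(V1,..,Vk,[ ],M1,..,Mm; M)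
  -- The value side conditions are the predicate ValidF.

  data Frame (Γ : Ctx A) : Ty A → Ty A → Set where
    appL : ∀ {σ τ} → Tm Γ σ → Frame Γ (σ ⇒ τ) τ
    appR : ∀ {σ τ} → Tm Γ (σ ⇒ τ) → Frame Γ σ τ
    boxF : ∀ {Δw Δz ρ τ} → Args Γ Δw → Args Γ Δz → Tm (Δw ++ ρ ∷ Δz) τ → Frame Γ (□ ρ) (□ τ)

  plugF : ∀ {Γ σ τ} → Frame Γ σ τ → Tm Γ σ → Tm Γ τ
  plugF (appL M)      t = app t M
  plugF (appR V)      t = app V t
  plugF (boxF W Q M)  t = box (W ++ᵃ (t ∷ Q)) M

  ValidF : ∀ {Γ σ τ} → Frame Γ σ τ → Set
  ValidF (appL M)     = ⊤
  ValidF (appR V)     = Value V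
  ValidF (boxF W Q M) = ValArgs W

  NotAppR : ∀ {Γ σ τ} → Frame Γ σ τ → Set
  NotAppR (appL M)     = ⊤
  NotAppR (appR V)     = ⊥
  NotAppR (boxF W Q M) = ⊤

  renF : ∀ {Γ Δ σ τ} → Ren Γ Δ → Frame Γ σ τ → Frame Δ σ τ
  renF ρ (appL M)     = appL (ren ρ M)
  renF ρ (appR V)     = appR (ren ρ V)
  renF ρ (boxF W Q M) = boxF (renA ρ W) (renA ρ Q) M

  data ECtx (Γ : Ctx A) : Ty A → Ty A → Set where
    hole : ∀ {σ} → ECtx Γ σ σ
    _·_  : ∀ {σ τ υ} → Frame Γ τ υ → ECtx Γ σ τ → ECtx Γ σ υ

  plugE : ∀ {Γ σ τ} → ECtx Γ σ τ → Tm Γ σ → Tm Γ τ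
  plugE hole    t = t
  plugE (C · E) t = plugF C (plugE E t)

  ValidE : ∀ {Γ σ τ} → ECtx Γ σ τ → Set
  ValidE hole    = ⊤
  ValidE (C · E) = ValidF C × ValidE E

  renE : ∀ {Γ Δ σ τ} → Ren Γ Δ → ECtx Γ σ τ → ECtx Δ σ τ
  renE ρ hole    = hole
  renE ρ (C · E) = renF ρ C · renE ρ E

  module Closure (_▷_ : ∀ {Γ σ} → Tm Γ σ → Tm Γ σ → Set) where
    data _⟶_ : ∀ {Γ σ} → Tm Γ σ → Tm Γ σ → Set
    data _⟶ᵃ_ : ∀ {Γ Δ} → Args Γ Δ → Args Γ Δ → Set

    data _⟶_ where
      base  : ∀ {Γ σ} {M N : Tm Γ σ} → M ▷ N → M ⟶ N
      ξlam  : ∀ {Γ σ τ} {M M' : Tm (σ ∷ Γ) τ} → M ⟶ M' → lam M ⟶ lam M'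
      ξappL : ∀ {Γ σ τ} {M M' : Tm Γ (σ ⇒ τ)} {N} → M ⟶ M' → app M N ⟶ app M' N
      ξappR : ∀ {Γ σ τ} {M : Tm Γ (σ ⇒ τ)} {N N'} → N ⟶ N' → app M N ⟶ app M N'
      ξboxA : ∀ {Γ Δ τ} {Ns Ns' : Args Γ Δ} {M : Tm Δ τ} → Ns ⟶ᵃ Ns' → box Ns M ⟶ box Ns' M
      ξboxB : ∀ {Γ Δ τ} {Ns : Args Γ Δ} {M M' : Tm Δ τ} → M ⟶ M' → box Ns M ⟶ box Ns M'

    data _⟶ᵃ_ where
      here  : ∀ {Γ σ Δ} {N N' : Tm Γ (□ σ)} {Ns : Args Γ Δ} → N ⟶ N' → (N ∷ Ns) ⟶ᵃ (N' ∷ Ns)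
      there : ∀ {Γ σ Δ} {N : Tm Γ (□ σ)} {Ns Ns' : Args Γ Δ} → Ns ⟶ᵃ Ns' → (N ∷ Ns) ⟶ᵃ (N ∷ Ns')

  data _▷n_ : ∀ {Γ σ} → Tm Γ σ → Tm Γ σ → Set where
    β    : ∀ {Γ σ τ} {M : Tm (σ ∷ Γ) τ} {N} → app (lam M) N ▷n (M [ N ])
    η    : ∀ {Γ σ τ} {M : Tm Γ (σ ⇒ τ)} → lam (app (wk M) (var ze)) ▷n M
    □id  : ∀ {Γ σ} {M : Tm Γ (□ σ)} → box (M ∷ []) (var ze) ▷n M
    □□   : ∀ {Γ Δw Δy Δz ρ τ} {P : Args Γ Δw} {L : Args Γ Δy} {N : Tm Δy ρ}
             {Q : Args Γ Δz} {M : Tm (Δw ++ ρ ∷ Δz) τ} →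
           box (P ++ᵃ (box L N ∷ Q)) M ▷n box (P ++ᵃ (L ++ᵃ Q)) (sub (boxSub Δw N) M)

  data _▷v_ : ∀ {Γ σ} → Tm Γ σ → Tm Γ σ → Set where
    idβ  : ∀ {Γ σ} {M : Tm Γ σ} → app (lam (var ze)) M ▷v M
    βv   : ∀ {Γ σ τ} {M : Tm (σ ∷ Γ) τ} {V} → Value V → app (lam M) V ▷v (M [ V ])
    ηv   : ∀ {Γ σ τ} {V : Tm Γ (σ ⇒ τ)} → Value V → lam (app (wk V) (var ze)) ▷v V
    letC : ∀ {Γ σ τ υ} {C : Frame Γ τ υ} {M : Tm (σ ∷ Γ) τ} {N : Tm Γ σ} → ValidF C →
           plugF C (app (lam M) N) ▷v app (lam (plugF (renF su C) M)) N
    letV : ∀ {Γ σ τ υ} {C : Frame Γ τ υ} {y : Γ ∋ σ ⇒ τ} {M : Tm Γ σ} → ValidF C → NotAppR C →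
           plugF C (app (var y) M) ▷v app (lam (plugF (renF su C) (var ze))) (app (var y) M)
    letE : ∀ {Γ σ τ υ} {E : ECtx Γ τ υ} {y : Γ ∋ σ ⇒ τ} {M : Tm Γ σ} → ValidE E →
           app (lam (plugE (renE su E) (app (var (su y)) (var ze)))) M ▷v plugE E (app (var y) M)
    □id  : ∀ {Γ σ} {M : Tm Γ (□ σ)} → box (M ∷ []) (var ze) ▷v M
    □□   : ∀ {Γ Δw Δy Δz ρ τ} {W : Args Γ Δw} {N : Args Γ Δy} {V : Tm Δy ρ}
             {P : Args Γ Δz} {M : Tm (Δw ++ ρ ∷ Δz) τ} → ValArgs W → Value V →
           box (W ++ᵃ (box N V ∷ P)) M ▷v box (W ++ᵃ (N ++ᵃ P)) (sub (boxSub Δw V) M)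

  _→n_ : ∀ {Γ σ} → Tm Γ σ → Tm Γ σ → Set
  _→n_ = Closure._⟶_ _▷n_

  _→v_ : ∀ {Γ σ} → Tm Γ σ → Tm Γ σ → Set
  _→v_ = Closure._⟶_ _▷v_

  _=n_ : ∀ {Γ σ} → Tm Γ σ → Tm Γ σ → Set
  _=n_ {Γ} {σ} = EqClosure (_→n_ {Γ} {σ})

  _=v_ : ∀ {Γ σ} → Tm Γ σ → Tm Γ σ → Set
  _=v_ {Γ} {σ} = EqClosure (_→v_ {Γ} {σ})

-- The modified CPS transformation, with R a fixed atomic type.
-- A constant c : σ of the source becomes the constant c at type σ† in
-- the target (target constants: TConst).

module CPS {A : Set} (Const : Ty A → Set) (R : A) where

  infix 10 _†
  _† : Ty A → Ty A
  atom p † = atom p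
  (σ ⇒ τ) † = (τ † ⇒ atom R) ⇒ σ † ⇒ atom R
  (□ σ) † = □ ((σ † ⇒ atom R) ⇒ atom R)

  K : Ty A → Ty A
  K σ = (σ † ⇒ atom R) ⇒ atom R

  TConst : Ty A → Set
  TConst τ = Σ (Ty A) (λ σ → (σ † ≡ τ) × Const σ)

  module S = Calculus Const
  module T = Calculus TConst

  ctx† : Ctx A → Ctx A
  ctx† = map _†

  var† : ∀ {Γ σ} → Γ ∋ σ → ctx† Γ ∋ σ †
  var† ze     = ze
  var† (su x) = su (var† x)

  lookupAll : ∀ {Ξ Θ : Ctx A} → All (Ξ ∋_) Θ → Ren Θ Ξ
  lookupAll (v ∷ vs) ze     = v
  lookupAll (v ∷ vs) (su x) = lookupAll vs x

  -- t⃗(λx⃗.P) = t1(λx1. t2(λx2. ... P ...)), P given Kripke-style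
  chain : ∀ {Ξ} (Bs : Ctx A) → All (λ B → T.Tm Ξ ((B ⇒ atom R) ⇒ atom R)) Bs →
          (∀ {Ξ'} → Ren Ξ Ξ' → All (Ξ' ∋_) Bs → T.Tm Ξ' (atom R)) → T.Tm Ξ (atom R)
  chain []       []       k = k (λ x → x) []
  chain (B ∷ Bs) (t ∷ ts) k =
    T.app t (T.lam (chain Bs (All.map T.wk ts) (λ ρ env → k (λ x → ρ (su x)) (ρ ze ∷ env))))

  zvars : ∀ {Ξ} (Δ : Ctx A) → Ren (map K Δ) Ξ → All (λ B → T.Tm Ξ ((B ⇒ atom R) ⇒ atom R)) (map _† Δ)
  zvars []      ρ = []
  zvars (σ ∷ Δ) ρ = T.var (ρ ze) ∷ zvars Δ (λ x → ρ (su x))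

  ysArgs : ∀ {Ξ} (Δ : Ctx A) → All (Ξ ∋_) (map (λ σ → (□ σ) †) Δ) → T.Args Ξ (map K Δ)
  ysArgs []      []       = T.[]
  ysArgs (σ ∷ Δ) (y ∷ ys) = T.var y T.∷ ysArgs Δ ys

  ⟦_⟧  : ∀ {Γ σ} → S.Tm Γ σ → T.Tm (ctx† Γ) (K σ)
  ⟦_⟧ᵃ : ∀ {Γ Δ} → S.Args Γ Δ →
         All (λ B → T.Tm (ctx† Γ) ((B ⇒ atom R) ⇒ atom R)) (map (λ σ → (□ σ) †) Δ)

  -- [[c]] = λk.kc ,  [[x]] = λk.kx
  ⟦ S.con {σ = σ} c ⟧ = T.lam (T.app (T.var ze) (T.con (σ , refl , c)))
  ⟦ S.var x ⟧ = T.lam (T.app (T.var ze) (T.var (su (var† x))))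
  -- [[λx.M]] = λk.k(λk'.λx.[[M]]k')
  ⟦ S.lam M ⟧ = T.lam (T.app (T.var ze) (T.lam (T.lam (T.app (T.ren ρ ⟦ M ⟧) (T.var (su ze))))))
    where
    ρ : Ren _ _
    ρ ze     = ze
    ρ (su x) = su (su (su x))
  -- [[MN]] = λk.[[M]](λy.[[N]](yk))
  ⟦ S.app M N ⟧ =
    T.lam (T.app (T.wk ⟦ M ⟧)
                 (T.lam (T.app (T.wk (T.wk ⟦ N ⟧)) (T.app (T.var ze) (T.var (su ze))))))
  -- [[box_x⃗(N⃗;M)]] = λk.[[N⃗]](λy⃗. k(box_z⃗(y⃗; λh. z⃗(λx⃗.[[M]]h))))
  ⟦ S.box {Δ = Δ} Ns M ⟧ =
    T.lam (chain (map (λ σ → (□ σ) †) Δ) (All.map T.wk ⟦ Ns ⟧ᵃ) (λ ρ ys →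
      T.app (T.var (ρ ze))
            (T.box (ysArgs Δ ys)
                   (T.lam (chain (map _† Δ) (zvars Δ su) (λ ρ' xs →
                      T.app (T.ren (lookupAll xs) ⟦ M ⟧) (T.var (ρ' ze))))))))

  ⟦ S.[] ⟧ᵃ     = []
  ⟦ N S.∷ Ns ⟧ᵃ = ⟦ N ⟧ ∷ ⟦ Ns ⟧ᵃ

-- The translation of a value V returns immediately: ⟦ V ⟧ =n λk.kW for some W.
-- Consequently substituting a value in the source is mirrored by substituting W in
-- the target, which validates βv and ηv, and an evaluation context E becomes a
-- continuation κ with ⟦ E[P] ⟧ =n λk.⟦ P ⟧κ, under which the let-rules are instances
-- of β and η.  The translation of box_x⃗(N⃗;M) first runs the computations ⟦ N⃗ ⟧ and
-- then boxes their results; when these are values the runs can be inlined, so a box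
-- nested in the arguments is flattened by the target □□ rule, whose substitution into
-- the translated body agrees with the translation of M[x:=V].  Every →v step thus
-- becomes an =n equation, and =v is folded into =n.

module Submission where

open import Data.List using (List; []; _∷_; _++_; map)
open import Data.List.Properties using (map-++)
open import Data.List.Relation.Unary.All as All using (All; []; _∷_)
open import Data.List.Relation.Unary.All.Properties using (map-∘; map-cong; map-id)
open import Data.Product using (Σ; _×_; _,_)
open import Data.Unit using (⊤; tt)
open import Defs
open import Relation.Binary.Construct.Closure.Equivalence as EQ using ()
open import Relation.Binary.Construct.Closure.ReflexiveTransitive using (ε; _◅_; _◅◅_)
open import Relation.Binary.Construct.Closure.Symmetric using (fwd)
open import Relation.Binary.PropositionalEquality using (_≡_; refl; sym; trans; cong; cong₂; subst; subst₂; module ≡-Reasoning)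
import Relation.Binary.Reasoning.Setoid as SetoidReasoning

module Metatheory {A : Set} (Const : Ty A → Set) where
  open Calculus Const public
  open Closure _▷n_ public

  infix 4 _≗r_ _≗s_

  _≗r_ : ∀ {Γ Δ : Ctx A} → Ren Γ Δ → Ren Γ Δ → Set
  ρ₁ ≗r ρ₂ = ∀ {σ} x → ρ₁ {σ} x ≡ ρ₂ x

  _≗s_ : ∀ {Γ Δ : Ctx A} → Sub Γ Δ → Sub Γ Δ → Set
  s₁ ≗s s₂ = ∀ {σ} x → s₁ {σ} x ≡ s₂ x

  ext-cong : ∀ {Γ Δ σ} {ρ₁ ρ₂ : Ren Γ Δ} → ρ₁ ≗r ρ₂ → ext {σ = σ} ρ₁ ≗r ext ρ₂
  ext-cong e ze     = refl
  ext-cong e (su x) = cong su (e x)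

  ren-cong  : ∀ {Γ Δ σ} {ρ₁ ρ₂ : Ren Γ Δ} → ρ₁ ≗r ρ₂ → (M : Tm Γ σ) → ren ρ₁ M ≡ ren ρ₂ M
  renA-cong : ∀ {Γ Δ Θ} {ρ₁ ρ₂ : Ren Γ Δ} → ρ₁ ≗r ρ₂ → (Ms : Args Γ Θ) → renA ρ₁ Ms ≡ renA ρ₂ Ms
  ren-cong e (con c)    = refl
  ren-cong e (var x)    = cong var (e x)
  ren-cong e (lam M)    = cong lam (ren-cong (ext-cong e) M)
  ren-cong e (app M N)  = cong₂ app (ren-cong e M) (ren-cong e N)
  ren-cong e (box Ns M) = cong (λ Ns → box Ns M) (renA-cong e Ns)
  renA-cong e []       = refl
  renA-cong e (N ∷ Ns) = cong₂ _∷_ (ren-cong e N) (renA-cong e Ns)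

  exts-cong : ∀ {Γ Δ σ} {s₁ s₂ : Sub Γ Δ} → s₁ ≗s s₂ → exts {σ = σ} s₁ ≗s exts s₂
  exts-cong e ze     = refl
  exts-cong e (su x) = cong wk (e x)

  sub-cong  : ∀ {Γ Δ σ} {s₁ s₂ : Sub Γ Δ} → s₁ ≗s s₂ → (M : Tm Γ σ) → sub s₁ M ≡ sub s₂ M
  subA-cong : ∀ {Γ Δ Θ} {s₁ s₂ : Sub Γ Δ} → s₁ ≗s s₂ → (Ms : Args Γ Θ) → subA s₁ Ms ≡ subA s₂ Ms
  sub-cong e (con c)    = refl
  sub-cong e (var x)    = e x
  sub-cong e (lam M)    = cong lam (sub-cong (exts-cong e) M)
  sub-cong e (app M N)  = cong₂ app (sub-cong e M) (sub-cong e N)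
  sub-cong e (box Ns M) = cong (λ Ns → box Ns M) (subA-cong e Ns)
  subA-cong e []       = refl
  subA-cong e (N ∷ Ns) = cong₂ _∷_ (sub-cong e N) (subA-cong e Ns)

  ren-ren  : ∀ {Γ Δ Θ σ} (ρ₁ : Ren Δ Θ) (ρ₂ : Ren Γ Δ) (M : Tm Γ σ) →
             ren ρ₁ (ren ρ₂ M) ≡ ren (λ x → ρ₁ (ρ₂ x)) M
  renA-ren : ∀ {Γ Δ Θ Ω} (ρ₁ : Ren Δ Θ) (ρ₂ : Ren Γ Δ) (Ms : Args Γ Ω) →
             renA ρ₁ (renA ρ₂ Ms) ≡ renA (λ x → ρ₁ (ρ₂ x)) Ms
  ren-ren ρ₁ ρ₂ (con c)    = refl
  ren-ren ρ₁ ρ₂ (var x)    = refl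
  ren-ren ρ₁ ρ₂ (lam M)    =
    cong lam (trans (ren-ren (ext ρ₁) (ext ρ₂) M) (ren-cong (λ { ze → refl ; (su x) → refl }) M))
  ren-ren ρ₁ ρ₂ (app M N)  = cong₂ app (ren-ren ρ₁ ρ₂ M) (ren-ren ρ₁ ρ₂ N)
  ren-ren ρ₁ ρ₂ (box Ns M) = cong (λ Ns → box Ns M) (renA-ren ρ₁ ρ₂ Ns)
  renA-ren ρ₁ ρ₂ []       = refl
  renA-ren ρ₁ ρ₂ (N ∷ Ns) = cong₂ _∷_ (ren-ren ρ₁ ρ₂ N) (renA-ren ρ₁ ρ₂ Ns)

  ren-id  : ∀ {Γ σ} (M : Tm Γ σ) → ren (λ x → x) M ≡ M
  renA-id : ∀ {Γ Θ} (Ms : Args Γ Θ) → renA (λ x → x) Ms ≡ Ms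
  ren-id (con c)    = refl
  ren-id (var x)    = refl
  ren-id (lam M)    = cong lam (trans (ren-cong (λ { ze → refl ; (su x) → refl }) M) (ren-id M))
  ren-id (app M N)  = cong₂ app (ren-id M) (ren-id N)
  ren-id (box Ns M) = cong (λ Ns → box Ns M) (renA-id Ns)
  renA-id []       = refl
  renA-id (N ∷ Ns) = cong₂ _∷_ (ren-id N) (renA-id Ns)

  ren-sub  : ∀ {Γ Δ Θ σ} (ρ : Ren Δ Θ) (s : Sub Γ Δ) (M : Tm Γ σ) →
             ren ρ (sub s M) ≡ sub (λ x → ren ρ (s x)) M
  renA-sub : ∀ {Γ Δ Θ Ω} (ρ : Ren Δ Θ) (s : Sub Γ Δ) (Ms : Args Γ Ω) →
             renA ρ (subA s Ms) ≡ subA (λ x → ren ρ (s x)) Ms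
  ren-sub ρ s (con c)    = refl
  ren-sub ρ s (var x)    = refl
  ren-sub ρ s (lam M)    = cong lam (trans (ren-sub (ext ρ) (exts s) M) (sub-cong ext-exts M))
    where
    ext-exts : (λ x → ren (ext ρ) (exts s x)) ≗s exts (λ x → ren ρ (s x))
    ext-exts ze     = refl
    ext-exts (su x) = trans (ren-ren (ext ρ) su (s x)) (sym (ren-ren su ρ (s x)))
  ren-sub ρ s (app M N)  = cong₂ app (ren-sub ρ s M) (ren-sub ρ s N)
  ren-sub ρ s (box Ns M) = cong (λ Ns → box Ns M) (renA-sub ρ s Ns)
  renA-sub ρ s []       = refl
  renA-sub ρ s (N ∷ Ns) = cong₂ _∷_ (ren-sub ρ s N) (renA-sub ρ s Ns)

  sub-ren  : ∀ {Γ Δ Θ σ} (s : Sub Δ Θ) (ρ : Ren Γ Δ) (M : Tm Γ σ) →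
             sub s (ren ρ M) ≡ sub (λ x → s (ρ x)) M
  subA-ren : ∀ {Γ Δ Θ Ω} (s : Sub Δ Θ) (ρ : Ren Γ Δ) (Ms : Args Γ Ω) →
             subA s (renA ρ Ms) ≡ subA (λ x → s (ρ x)) Ms
  sub-ren s ρ (con c)    = refl
  sub-ren s ρ (var x)    = refl
  sub-ren s ρ (lam M)    =
    cong lam (trans (sub-ren (exts s) (ext ρ) M) (sub-cong (λ { ze → refl ; (su x) → refl }) M))
  sub-ren s ρ (app M N)  = cong₂ app (sub-ren s ρ M) (sub-ren s ρ N)
  sub-ren s ρ (box Ns M) = cong (λ Ns → box Ns M) (subA-ren s ρ Ns)
  subA-ren s ρ []       = refl
  subA-ren s ρ (N ∷ Ns) = cong₂ _∷_ (sub-ren s ρ N) (subA-ren s ρ Ns)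

  sub-sub  : ∀ {Γ Δ Θ σ} (s₁ : Sub Δ Θ) (s₂ : Sub Γ Δ) (M : Tm Γ σ) →
             sub s₁ (sub s₂ M) ≡ sub (λ x → sub s₁ (s₂ x)) M
  subA-sub : ∀ {Γ Δ Θ Ω} (s₁ : Sub Δ Θ) (s₂ : Sub Γ Δ) (Ms : Args Γ Ω) →
             subA s₁ (subA s₂ Ms) ≡ subA (λ x → sub s₁ (s₂ x)) Ms
  sub-sub s₁ s₂ (con c)    = refl
  sub-sub s₁ s₂ (var x)    = refl
  sub-sub s₁ s₂ (lam M)    = cong lam (trans (sub-sub (exts s₁) (exts s₂) M) (sub-cong exts-exts M))
    where
    exts-exts : (λ x → sub (exts s₁) (exts s₂ x)) ≗s exts (λ x → sub s₁ (s₂ x))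
    exts-exts ze     = refl
    exts-exts (su x) = trans (sub-ren (exts s₁) su (s₂ x)) (sym (ren-sub su s₁ (s₂ x)))
  sub-sub s₁ s₂ (app M N)  = cong₂ app (sub-sub s₁ s₂ M) (sub-sub s₁ s₂ N)
  sub-sub s₁ s₂ (box Ns M) = cong (λ Ns → box Ns M) (subA-sub s₁ s₂ Ns)
  subA-sub s₁ s₂ []       = refl
  subA-sub s₁ s₂ (N ∷ Ns) = cong₂ _∷_ (sub-sub s₁ s₂ N) (subA-sub s₁ s₂ Ns)

  sub-id  : ∀ {Γ σ} (M : Tm Γ σ) → sub var M ≡ M
  subA-id : ∀ {Γ Θ} (Ms : Args Γ Θ) → subA var Ms ≡ Ms
  sub-id (con c)    = refl
  sub-id (var x)    = refl
  sub-id (lam M)    = cong lam (trans (sub-cong (λ { ze → refl ; (su x) → refl }) M) (sub-id M))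
  sub-id (app M N)  = cong₂ app (sub-id M) (sub-id N)
  sub-id (box Ns M) = cong (λ Ns → box Ns M) (subA-id Ns)
  subA-id []       = refl
  subA-id (N ∷ Ns) = cong₂ _∷_ (sub-id N) (subA-id Ns)

  ren≡sub : ∀ {Γ Δ σ} (ρ : Ren Γ Δ) (M : Tm Γ σ) → ren ρ M ≡ sub (λ x → var (ρ x)) M
  ren≡sub ρ M = trans (sym (sub-id (ren ρ M))) (sub-ren var ρ M)

  wk-ren : ∀ {Γ Δ σ τ} (ρ : Ren Γ Δ) (M : Tm Γ σ) → wk {τ = τ} (ren ρ M) ≡ ren (ext ρ) (wk M)
  wk-ren ρ M = trans (ren-ren su ρ M) (sym (ren-ren (ext ρ) su M))

  wk-sub : ∀ {Γ Δ σ τ} (s : Sub Γ Δ) (M : Tm Γ σ) → wk {τ = τ} (sub s M) ≡ sub (exts s) (wk M)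
  wk-sub s M = trans (ren-sub su s M) (sym (sub-ren (exts s) su M))

  sub-single-wk : ∀ {Γ σ τ} (N : Tm Γ σ) (M : Tm Γ τ) → wk M [ N ] ≡ M
  sub-single-wk N M = trans (sub-ren (single N) su M) (sub-id M)

  sub-[] : ∀ {Γ Δ σ τ} (s : Sub Γ Δ) (M : Tm (σ ∷ Γ) τ) (N : Tm Γ σ) →
           sub s (M [ N ]) ≡ sub (exts s) M [ sub s N ]
  sub-[] s M N = trans (sub-sub s (single N) M) (sym (trans (sub-sub _ (exts s) M) (sub-cong single-exts M)))
    where
    single-exts : (λ x → sub (single (sub s N)) (exts s x)) ≗s (λ x → sub s (single N x))
    single-exts ze     = refl
    single-exts (su x) = sub-single-wk (sub s N) (s x)

  subA-++ : ∀ {Γ Δ Θ₁ Θ₂} (s : Sub Γ Δ) (Ps : Args Γ Θ₁) (Qs : Args Γ Θ₂) →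
            subA s (Ps ++ᵃ Qs) ≡ subA s Ps ++ᵃ subA s Qs
  subA-++ s []       Qs = refl
  subA-++ s (P ∷ Ps) Qs = cong (sub s P ∷_) (subA-++ s Ps Qs)

  sub-▷ : ∀ {Γ Δ σ} (s : Sub Γ Δ) {M N : Tm Γ σ} → M ▷n N → sub s M ⟶ sub s N
  sub-▷ s (β {M = M} {N}) = subst (app (lam (sub (exts s) M)) (sub s N) ⟶_) (sym (sub-[] s M N)) (base β)
  sub-▷ s (η {M = M})     = subst (λ M' → lam (app M' (var ze)) ⟶ sub s M) (wk-sub s M) (base η)
  sub-▷ s □id             = base □id
  sub-▷ s (□□ {P = P} {L} {N} {Q} {M}) =
    subst₂ (λ Ps Qs → box Ps M ⟶ box Qs _)
      (sym (subA-++ s P (box L N ∷ Q)))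
      (sym (trans (subA-++ s P (L ++ᵃ Q)) (cong (subA s P ++ᵃ_) (subA-++ s L Q))))
      (base □□)

  sub-⟶  : ∀ {Γ Δ σ} (s : Sub Γ Δ) {M N : Tm Γ σ} → M ⟶ N → sub s M ⟶ sub s N
  subA-⟶ : ∀ {Γ Δ Θ} (s : Sub Γ Δ) {Ms Ns : Args Γ Θ} → Ms ⟶ᵃ Ns → subA s Ms ⟶ᵃ subA s Ns
  sub-⟶ s (base r)  = sub-▷ s r
  sub-⟶ s (ξlam r)  = ξlam (sub-⟶ (exts s) r)
  sub-⟶ s (ξappL r) = ξappL (sub-⟶ s r)
  sub-⟶ s (ξappR r) = ξappR (sub-⟶ s r)
  sub-⟶ s (ξboxA r) = ξboxA (subA-⟶ s r)
  sub-⟶ s (ξboxB r) = ξboxB r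
  subA-⟶ s (here r)  = here (sub-⟶ s r)
  subA-⟶ s (there r) = there (subA-⟶ s r)

  infix 4 _≈_
  _≈_ : ∀ {Γ σ} → Tm Γ σ → Tm Γ σ → Set
  _≈_ = _=n_

  module ≈-Reasoning {Γ σ} = SetoidReasoning (EQ.setoid (_⟶_ {Γ} {σ}))

  ≈-refl : ∀ {Γ σ} {M : Tm Γ σ} → M ≈ M
  ≈-refl = ε

  ≈-sym : ∀ {Γ σ} {M N : Tm Γ σ} → M ≈ N → N ≈ M
  ≈-sym = EQ.symmetric _

  ≈-trans : ∀ {Γ σ} {M N P : Tm Γ σ} → M ≈ N → N ≈ P → M ≈ P
  ≈-trans = _◅◅_

  ⟶⇒≈ : ∀ {Γ σ} {M N : Tm Γ σ} → M ⟶ N → M ≈ N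
  ⟶⇒≈ r = fwd r ◅ ε

  ▷⇒≈ : ∀ {Γ σ} {M N : Tm Γ σ} → M ▷n N → M ≈ N
  ▷⇒≈ r = ⟶⇒≈ (base r)

  ≡⇒≈ : ∀ {Γ σ} {M N : Tm Γ σ} → M ≡ N → M ≈ N
  ≡⇒≈ refl = ε

  β≈ : ∀ {Γ σ τ} {M : Tm (σ ∷ Γ) τ} {N} → app (lam M) N ≈ M [ N ]
  β≈ = ▷⇒≈ β

  η≈ : ∀ {Γ σ τ} (M : Tm Γ (σ ⇒ τ)) → lam (app (wk M) (var ze)) ≈ M
  η≈ M = ▷⇒≈ η

  ≈-cong : ∀ {Γ σ Δ τ} (f : Tm Γ σ → Tm Δ τ) → (∀ {M N} → M ⟶ N → f M ⟶ f N) →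
           ∀ {M N} → M ≈ N → f M ≈ f N
  ≈-cong f f-mono = EQ.gmap f f-mono

  sub≈ : ∀ {Γ Δ σ} (s : Sub Γ Δ) {M N : Tm Γ σ} → M ≈ N → sub s M ≈ sub s N
  sub≈ s = ≈-cong (sub s) (sub-⟶ s)

  ren≈ : ∀ {Γ Δ σ} (ρ : Ren Γ Δ) {M N : Tm Γ σ} → M ≈ N → ren ρ M ≈ ren ρ N
  ren≈ ρ {M} {N} M≈N = begin
    ren ρ M                  ≡⟨ ren≡sub ρ M ⟩
    sub (λ x → var (ρ x)) M  ≈⟨ sub≈ _ M≈N ⟩
    sub (λ x → var (ρ x)) N  ≡⟨ ren≡sub ρ N ⟨
    ren ρ N                  ∎
    where open ≈-Reasoning

  lam≈ : ∀ {Γ σ τ} {M N : Tm (σ ∷ Γ) τ} → M ≈ N → lam M ≈ lam N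
  lam≈ = ≈-cong lam ξlam

  appL≈ : ∀ {Γ σ τ} {M N : Tm Γ (σ ⇒ τ)} {P} → M ≈ N → app M P ≈ app N P
  appL≈ = ≈-cong _ ξappL

  appR≈ : ∀ {Γ σ τ} {P : Tm Γ (σ ⇒ τ)} {M N} → M ≈ N → app P M ≈ app P N
  appR≈ = ≈-cong _ ξappR

  boxB≈ : ∀ {Γ Δ τ} {Ns : Args Γ Δ} {M N : Tm Δ τ} → M ≈ N → box Ns M ≈ box Ns N
  boxB≈ = ≈-cong _ ξboxB

module Soundness {A : Set} (Const : Ty A → Set) (R : A) where
  open CPS Const R
  open Metatheory TConst

  -- Sequencing of computations

  Comp : Ty A → Ty A
  Comp B = (B ⇒ atom R) ⇒ atom R

  return : ∀ {Ξ B} → Tm Ξ B → Tm Ξ (Comp B)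
  return W = lam (app (var ze) (wk W))

  ren-return : ∀ {Ξ Θ B} (ρ : Ren Ξ Θ) (W : Tm Ξ B) → ren ρ (return W) ≡ return (ren ρ W)
  ren-return ρ W = cong (λ W' → lam (app (var ze) W')) (sym (wk-ren ρ W))

  sub-return : ∀ {Ξ Θ B} (s : Sub Ξ Θ) (W : Tm Ξ B) → sub s (return W) ≡ return (sub s W)
  sub-return s W = cong (λ W' → lam (app (var ze) W')) (sym (wk-sub s W))

  return-app : ∀ {Ξ B} (W : Tm Ξ B) (k : Tm Ξ (B ⇒ atom R)) → app (return W) k ≈ app k W
  return-app W k = ≈-trans β≈ (≡⇒≈ (cong (app k) (sub-single-wk k W)))

  map-fuse : ∀ {P Q U : Ty A → Set} {Bs} {f : ∀ {B} → Q B → U B} {g : ∀ {B} → P B → Q B} {h : ∀ {B} → P B → U B} →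
             (∀ {B} (t : P B) → f (g t) ≡ h t) → (ts : All P Bs) → All.map f (All.map g ts) ≡ All.map h ts
  map-fuse eq ts = trans (map-∘ ts) (map-cong ts eq)

  Comps : Ctx A → List (Ty A) → Set
  Comps Ξ Bs = All (λ B → Tm Ξ (Comp B)) Bs

  -- Continuations accept a substitution into any context, so that sequencing commutes
  -- with substitution (sub-bindAll).
  Cont : Ctx A → List (Ty A) → Set
  Cont Ξ Bs = ∀ {Θ} → Sub Ξ Θ → All (Tm Θ) Bs → Tm Θ (atom R)

  -- bindAll Bs (t₁ ∷ … ∷ tₙ) k is the paper's t₁(λx₁.⋯tₙ(λxₙ.k x⃗)⋯).
  bindAll : ∀ {Ξ} Bs → Comps Ξ Bs → Cont Ξ Bs → Tm Ξ (atom R)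
  bindAll []       []       k = k var []
  bindAll (B ∷ Bs) (t ∷ ts) k = app t (lam (bindAll Bs (All.map wk ts) (λ s Ws → k (λ x → s (su x)) (s ze ∷ Ws))))

  record Natural {Ξ Bs} (k : Cont Ξ Bs) : Set where
    field
      resp-≗s : ∀ {Θ} {s₁ s₂ : Sub Ξ Θ} Ws → s₁ ≗s s₂ → k s₁ Ws ≡ k s₂ Ws
      sub-k   : ∀ {Θ Θ'} (s : Sub Ξ Θ) (s' : Sub Θ Θ') Ws →
                sub s' (k s Ws) ≡ k (λ x → sub s' (s x)) (All.map (sub s') Ws)
  open Natural public

  bindAll-cong : ∀ {Ξ} Bs (ts : Comps Ξ Bs) {k₁ k₂ : Cont Ξ Bs} →
                 (∀ {Θ} (s : Sub Ξ Θ) Ws → k₁ s Ws ≡ k₂ s Ws) → bindAll Bs ts k₁ ≡ bindAll Bs ts k₂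
  bindAll-cong []       []       k₁≡k₂ = k₁≡k₂ var []
  bindAll-cong (B ∷ Bs) (t ∷ ts) k₁≡k₂ = cong (λ b → app t (lam b)) (bindAll-cong Bs (All.map wk ts) (λ s Ws → k₁≡k₂ _ _))

  bindAll-cong≈ : ∀ {Ξ} Bs (ts : Comps Ξ Bs) {k₁ k₂ : Cont Ξ Bs} →
                  (∀ {Θ} (s : Sub Ξ Θ) Ws → k₁ s Ws ≈ k₂ s Ws) → bindAll Bs ts k₁ ≈ bindAll Bs ts k₂
  bindAll-cong≈ []       []       k₁≈k₂ = k₁≈k₂ var []
  bindAll-cong≈ (B ∷ Bs) (t ∷ ts) k₁≈k₂ = appR≈ (lam≈ (bindAll-cong≈ Bs (All.map wk ts) (λ s Ws → k₁≈k₂ _ _)))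

  infix 4 _≈*_
  data _≈*_ {Ξ} : ∀ {Bs} → Comps Ξ Bs → Comps Ξ Bs → Set where
    []  : [] ≈* []
    _∷_ : ∀ {B Bs} {t t' : Tm Ξ (Comp B)} {ts ts' : Comps Ξ Bs} → t ≈ t' → ts ≈* ts' → (t ∷ ts) ≈* (t' ∷ ts')

  ≈*-refl : ∀ {Ξ Bs} (ts : Comps Ξ Bs) → ts ≈* ts
  ≈*-refl []       = []
  ≈*-refl (t ∷ ts) = ≈-refl ∷ ≈*-refl ts

  ≈*-ren : ∀ {Ξ Θ Bs} (ρ : Ren Ξ Θ) {ts ts' : Comps Ξ Bs} → ts ≈* ts' → All.map (ren ρ) ts ≈* All.map (ren ρ) ts'
  ≈*-ren ρ []       = []
  ≈*-ren ρ (e ∷ es) = ren≈ ρ e ∷ ≈*-ren ρ es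

  bindAll-≈* : ∀ {Ξ} Bs {ts ts' : Comps Ξ Bs} (k : Cont Ξ Bs) → ts ≈* ts' → bindAll Bs ts k ≈ bindAll Bs ts' k
  bindAll-≈* []       k []       = ≈-refl
  bindAll-≈* (B ∷ Bs) k (e ∷ es) = ≈-trans (appL≈ e) (appR≈ (lam≈ (bindAll-≈* Bs _ (≈*-ren su es))))

  natural-tail : ∀ {Ξ B Bs} {k : Cont Ξ (B ∷ Bs)} → Natural k →
                 Natural {B ∷ Ξ} {Bs} (λ s Ws → k (λ x → s (su x)) (s ze ∷ Ws))
  natural-tail {k = k} n = record
    { resp-≗s = λ {_} {s₁} {s₂} Ws s₁≗s₂ →
        trans (resp-≗s n (s₁ ze ∷ Ws) (λ x → s₁≗s₂ (su x))) (cong (λ W → k (λ x → s₂ (su x)) (W ∷ Ws)) (s₁≗s₂ ze))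
    ; sub-k   = λ s s' Ws → sub-k n (λ x → s (su x)) s' (s ze ∷ Ws)
    }

  natural-push : ∀ {Ξ B Bs} {k : Cont Ξ (B ∷ Bs)} → Natural k → (W : Tm Ξ B) →
                 Natural {Ξ} {Bs} (λ s Ws → k s (sub s W ∷ Ws))
  natural-push {k = k} n W = record
    { resp-≗s = λ {_} {s₁} {s₂} Ws s₁≗s₂ →
        trans (resp-≗s n _ s₁≗s₂) (cong (λ W' → k s₂ (W' ∷ Ws)) (sub-cong s₁≗s₂ W))
    ; sub-k   = λ s s' Ws → trans (sub-k n s s' _) (cong (λ W' → k _ (W' ∷ _)) (sub-sub s' s W))
    }

  sub-bindAll : ∀ {Ξ Θ} Bs (ts : Comps Ξ Bs) (k : Cont Ξ Bs) → Natural k → (s : Sub Ξ Θ) →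
                sub s (bindAll Bs ts k) ≡ bindAll Bs (All.map (sub s) ts) (λ s' Ws → k (λ x → sub s' (s x)) Ws)
  sub-bindAll []       []       k n s = trans (sub-k n var s []) (resp-≗s n [] (λ x → sym (sub-id (s x))))
  sub-bindAll (B ∷ Bs) (t ∷ ts) k n s = cong (λ b → app (sub s t) (lam b)) (begin
    sub (exts s) (bindAll Bs (All.map wk ts) _)
      ≡⟨ sub-bindAll Bs (All.map wk ts) _ (natural-tail n) (exts s) ⟩
    bindAll Bs (All.map (sub (exts s)) (All.map wk ts)) _
      ≡⟨ cong (λ ts' → bindAll Bs ts' _) (trans (map-fuse (λ t → sym (wk-sub s t)) ts) (sym (map-∘ ts))) ⟩
    bindAll Bs (All.map wk (All.map (sub s) ts)) _
      ≡⟨ bindAll-cong Bs _ (λ s' Ws → resp-≗s n _ (λ x → sub-ren s' su (s x))) ⟩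
    bindAll Bs (All.map wk (All.map (sub s) ts)) _ ∎)
    where open ≡-Reasoning

  bindAll-return : ∀ {Ξ B Bs} (t : Tm Ξ (Comp B)) (ts : Comps Ξ Bs) (k : Cont Ξ (B ∷ Bs)) (W : Tm Ξ B) →
                   Natural k → t ≈ return W → bindAll (B ∷ Bs) (t ∷ ts) k ≈ bindAll Bs ts (λ s Ws → k s (sub s W ∷ Ws))
  bindAll-return {Bs = Bs} t ts k W n t≈W = begin
    app t (lam (bindAll Bs (All.map wk ts) _))
      ≈⟨ appL≈ t≈W ⟩
    app (return W) (lam (bindAll Bs (All.map wk ts) _))
      ≈⟨ return-app W _ ⟩
    app (lam (bindAll Bs (All.map wk ts) _)) W
      ≈⟨ β≈ ⟩
    bindAll Bs (All.map wk ts) _ [ W ]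
      ≡⟨ sub-bindAll Bs (All.map wk ts) _ (natural-tail n) (single W) ⟩
    bindAll Bs (All.map (sub (single W)) (All.map wk ts)) _
      ≡⟨ cong (λ ts' → bindAll Bs ts' _) (trans (map-fuse (sub-single-wk W) ts) (map-id ts)) ⟩
    bindAll Bs ts _ ∎
    where open ≈-Reasoning

  infix 4 _≈return*_
  data _≈return*_ {Ξ} : ∀ {Bs} → Comps Ξ Bs → All (Tm Ξ) Bs → Set where
    []  : [] ≈return* []
    _∷_ : ∀ {B Bs} {t : Tm Ξ (Comp B)} {W} {ts : Comps Ξ Bs} {Ws} →
          t ≈ return W → ts ≈return* Ws → (t ∷ ts) ≈return* (W ∷ Ws)

  ≈return*-ren : ∀ {Ξ Θ Bs} (ρ : Ren Ξ Θ) {ts : Comps Ξ Bs} {Ws} →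
                 ts ≈return* Ws → All.map (ren ρ) ts ≈return* All.map (ren ρ) Ws
  ≈return*-ren ρ []                   = []
  ≈return*-ren ρ (_∷_ {W = W} e es) = ≈-trans (ren≈ ρ e) (≡⇒≈ (ren-return ρ W)) ∷ ≈return*-ren ρ es

  bindAll-returns : ∀ {Ξ} Bs {ts : Comps Ξ Bs} {Ws} (k : Cont Ξ Bs) → Natural k → ts ≈return* Ws →
                    bindAll Bs ts k ≈ k var Ws
  bindAll-returns []       k n []                       = ≈-refl
  bindAll-returns (B ∷ Bs) {t ∷ ts} {W ∷ Ws} k n (e ∷ es) =
    ≈-trans (bindAll-return t ts k W n e)
      (≈-trans (bindAll-returns Bs _ (natural-push n W) es) (≡⇒≈ (cong (λ W' → k var (W' ∷ Ws)) (sub-id W))))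

  appendAll : ∀ {P : Ty A → Set} (f : Ty A → Ty A) (Δ : Ctx A) {X} → All P (map f Δ) → All P (map f X) → All P (map f (Δ ++ X))
  appendAll f []      []       ys = ys
  appendAll f (a ∷ Δ) (x ∷ xs) ys = x ∷ appendAll f Δ xs ys

  map-appendAll : ∀ {P Q : Ty A → Set} (f : Ty A → Ty A) (g : ∀ {B} → P B → Q B) (Δ : Ctx A) {X}
                  (xs : All P (map f Δ)) (ys : All P (map f X)) →
                  All.map g (appendAll f Δ xs ys) ≡ appendAll f Δ (All.map g xs) (All.map g ys)
  map-appendAll f g []      []       ys = refl
  map-appendAll f g (a ∷ Δ) (x ∷ xs) ys = cong (g x ∷_) (map-appendAll f g Δ xs ys)

  bindAll-++ : ∀ {Ξ} (f : Ty A → Ty A) (Δ X : Ctx A) (ts : Comps Ξ (map f Δ)) (ts' : Comps Ξ (map f X)) (k : Cont Ξ (map f (Δ ++ X))) →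
               bindAll (map f (Δ ++ X)) (appendAll f Δ ts ts') k ≡
               bindAll (map f Δ) ts (λ s Us → bindAll (map f X) (All.map (sub s) ts') (λ s' Ws → k (λ x → sub s' (s x)) (appendAll f Δ (All.map (sub s') Us) Ws)))
  bindAll-++ f []      X []       ts' k = trans (cong (λ ts → bindAll (map f X) ts k) (sym (trans (map-cong ts' sub-id) (map-id ts'))))
                                            (bindAll-cong (map f X) _ (λ s Ws → refl))
  bindAll-++ f (a ∷ Δ) X (t ∷ ts) ts' k = cong (λ b → app t (lam b))
    (trans (cong (λ ts'' → bindAll (map f (Δ ++ X)) ts'' _) (map-appendAll f wk Δ ts ts'))
    (trans (bindAll-++ f Δ X (All.map wk ts) (All.map wk ts') _)
           (bindAll-cong (map f Δ) (All.map wk ts) (λ s Us → cong (λ ts'' → bindAll (map f X) ts'' _) (map-fuse (sub-ren s su) ts')))))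

  natural-++ : ∀ {Ξ Θ} (f : Ty A → Ty A) (Δ X : Ctx A) {k : Cont Ξ (map f (Δ ++ X))} → Natural k →
               (s : Sub Ξ Θ) (Us : All (Tm Θ) (map f Δ)) →
               Natural {Θ} {map f X} (λ s' Ws → k (λ x → sub s' (s x)) (appendAll f Δ (All.map (sub s') Us) Ws))
  natural-++ f Δ X {k} n s Us = record
    { resp-≗s = λ {_} {s₁} {s₂} Ws s₁≗s₂ → trans (resp-≗s n _ (λ x → sub-cong s₁≗s₂ (s x)))
        (cong (λ Us' → k _ (appendAll f Δ Us' Ws)) (map-cong Us (sub-cong s₁≗s₂)))
    ; sub-k   = λ s₁ s₂ Ws → trans (sub-k n _ s₂ _) (trans (resp-≗s n _ (λ x → sub-sub s₂ s₁ (s x)))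
        (cong (k _) (trans (map-appendAll f (sub s₂) Δ _ Ws) (cong (λ Us' → appendAll f Δ Us' _) (map-fuse (sub-sub s₂ s₁) Us)))))
    }

  PrefixCont : ∀ {Ξ} (f : Ty A → Ty A) (Δ X : Ctx A) → Cont Ξ (map f (Δ ++ X)) → All (Tm Ξ) (map f Δ) → Cont Ξ (map f X)
  PrefixCont f Δ X k Us s Ws = k s (appendAll f Δ (All.map (sub s) Us) Ws)

  bindAll-returns-prefix : ∀ {Ξ} (f : Ty A → Ty A) (Δ X : Ctx A) {ts : Comps Ξ (map f Δ)} (ts' : Comps Ξ (map f X))
                           (k : Cont Ξ (map f (Δ ++ X))) {Us : All (Tm Ξ) (map f Δ)} → Natural k → ts ≈return* Us →
                           bindAll (map f (Δ ++ X)) (appendAll f Δ ts ts') k ≈ bindAll (map f X) ts' (PrefixCont f Δ X k Us)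
  bindAll-returns-prefix f []      X ts' k n []       = ≈-refl
  bindAll-returns-prefix f (a ∷ Δ) X {t ∷ ts} ts' k {U ∷ Us} n (t≈U ∷ ts≈Us) =
    ≈-trans (bindAll-return t (appendAll f Δ ts ts') k U n t≈U)
            (bindAll-returns-prefix f Δ X ts' _ (natural-push n U) ts≈Us)

  -- The shape of the translation

  □† : Ty A → Ty A
  □† σ = (□ σ) †

  toArgs : ∀ {Θ} (Δ : Ctx A) → All (Tm Θ) (map □† Δ) → Args Θ (map K Δ)
  toArgs []      []       = []
  toArgs (σ ∷ Δ) (W ∷ Ws) = W ∷ toArgs Δ Ws

  subA-toArgs : ∀ {Θ Θ'} (Δ : Ctx A) (s : Sub Θ Θ') (Ws : All (Tm Θ) (map □† Δ)) →
                subA s (toArgs Δ Ws) ≡ toArgs Δ (All.map (sub s) Ws)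
  subA-toArgs []      s []       = refl
  subA-toArgs (σ ∷ Δ) s (W ∷ Ws) = cong (sub s W ∷_) (subA-toArgs Δ s Ws)

  renA-toArgs : ∀ {Θ Θ'} (Δ : Ctx A) (ρ : Ren Θ Θ') (Ws : All (Tm Θ) (map □† Δ)) →
                renA ρ (toArgs Δ Ws) ≡ toArgs Δ (All.map (ren ρ) Ws)
  renA-toArgs []      ρ []       = refl
  renA-toArgs (σ ∷ Δ) ρ (W ∷ Ws) = cong (ren ρ W ∷_) (renA-toArgs Δ ρ Ws)

  ysArgs≡toArgs : ∀ {Θ} (Δ : Ctx A) (ys : All (Θ ∋_) (map □† Δ)) → ysArgs Δ ys ≡ toArgs Δ (All.map var ys)
  ysArgs≡toArgs []      []       = refl
  ysArgs≡toArgs (σ ∷ Δ) (y ∷ ys) = cong (var y ∷_) (ysArgs≡toArgs Δ ys)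

  env→sub : ∀ {Θ Bs} → All (Tm Θ) Bs → Sub Bs Θ
  env→sub (W ∷ Ws) ze     = W
  env→sub (W ∷ Ws) (su x) = env→sub Ws x

  env→sub-map : ∀ {Θ Θ' Bs} (f : ∀ {B} → Tm Θ B → Tm Θ' B) (Ws : All (Tm Θ) Bs) {B} (x : Bs ∋ B) →
                env→sub (All.map f Ws) x ≡ f (env→sub Ws x)
  env→sub-map f (W ∷ Ws) ze     = refl
  env→sub-map f (W ∷ Ws) (su x) = env→sub-map f Ws x

  env→sub-var : ∀ {Θ Bs} (xs : All (Θ ∋_) Bs) {B} (x : Bs ∋ B) → env→sub (All.map var xs) x ≡ var (lookupAll xs x)
  env→sub-var (y ∷ ys) ze     = refl
  env→sub-var (y ∷ ys) (su x) = env→sub-var ys x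

  kBox : ∀ {Ξ τ} (Δ : Ctx A) → Tm (map K Δ) (K τ) → Cont ((□† τ ⇒ atom R) ∷ Ξ) (map □† Δ)
  kBox Δ B s Ws = app (s ze) (box (toArgs Δ Ws) B)

  natural-kBox : ∀ {Ξ τ} (Δ : Ctx A) (B : Tm (map K Δ) (K τ)) → Natural {(□† τ ⇒ atom R) ∷ Ξ} (kBox Δ B)
  natural-kBox Δ B = record
    { resp-≗s = λ Ws s₁≗s₂ → cong (λ k → app k _) (s₁≗s₂ ze)
    ; sub-k   = λ s s' Ws → cong (λ Ns → app _ (box Ns B)) (subA-toArgs Δ s' Ws)
    }

  kBody : ∀ {Ξ} {Δ : Ctx A} {τ} → Tm (ctx† Δ) (K τ) → Cont ((τ † ⇒ atom R) ∷ Ξ) (map _† Δ)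
  kBody P s Ws = app (sub (env→sub Ws) P) (s ze)

  natural-kBody : ∀ {Ξ} {Δ : Ctx A} {τ} (P : Tm (ctx† Δ) (K τ)) → Natural (kBody {Ξ} {Δ} P)
  natural-kBody P = record
    { resp-≗s = λ Ws s₁≗s₂ → cong (app _) (s₁≗s₂ ze)
    ; sub-k   = λ s s' Ws → cong (λ P' → app P' _)
        (trans (sub-sub s' (env→sub Ws) P) (sub-cong (λ x → sym (env→sub-map (sub s') Ws x)) P))
    }

  values : ∀ {Ξ} (Δ : Ctx A) → Sub (map K Δ) Ξ → Comps Ξ (map _† Δ)
  values []      g = []
  values (a ∷ Δ) g = g ze ∷ values Δ (λ x → g (su x))

  -- λh.z⃗(λx⃗.P h), with the z⃗ given by g (⟦ box_x⃗(N⃗;M) ⟧ uses g = var).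
  boxBody : ∀ {Ξ τ} (Δ : Ctx A) → Tm (ctx† Δ) (K τ) → Sub (map K Δ) Ξ → Tm Ξ (K τ)
  boxBody Δ P g = lam (bindAll (map _† Δ) (values Δ (λ x → wk (g x))) (kBody P))

  -- λk.t⃗(λy⃗.k(box_z⃗(y⃗;B))).
  boxT : ∀ {Ξ τ} (Δ : Ctx A) → Comps Ξ (map □† Δ) → Tm (map K Δ) (K τ) → Tm Ξ (K (□ τ))
  boxT Δ ts B = lam (bindAll (map □† Δ) (All.map wk ts) (kBox Δ B))

  -- λk'.λx.P k'.
  lamK : ∀ {Ξ a b} → Tm (a ∷ Ξ) (Comp b) → Tm Ξ ((b ⇒ atom R) ⇒ a ⇒ atom R)
  lamK P = lam (lam (app (ren (ext su) P) (var (su ze))))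

  chain≡bindAll : ∀ {Ξ} Bs (ts : Comps Ξ Bs) (k : ∀ {Ξ'} → Ren Ξ Ξ' → All (Ξ' ∋_) Bs → Tm Ξ' (atom R)) (k' : Cont Ξ Bs) →
                  (∀ {Ξ'} (ρ : Ren Ξ Ξ') xs → k ρ xs ≡ k' (λ x → var (ρ x)) (All.map var xs)) →
                  chain Bs ts k ≡ bindAll Bs ts k'
  chain≡bindAll []       []       k k' k≡k' = k≡k' (λ x → x) []
  chain≡bindAll (B ∷ Bs) (t ∷ ts) k k' k≡k' =
    cong (λ b → app t (lam b)) (chain≡bindAll Bs (All.map wk ts) _ _ (λ ρ xs → k≡k' _ _))

  ⟦lam⟧ : ∀ {Γ σ τ} (M : S.Tm (σ ∷ Γ) τ) → ⟦ S.lam M ⟧ ≡ return (lamK ⟦ M ⟧)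
  ⟦lam⟧ M = cong (λ P → lam (app (var ze) (lam (lam (app P (var (su ze)))))))
    (sym (trans (ren-ren _ (ext su) ⟦ M ⟧) (ren-cong (λ { ze → refl ; (su x) → refl }) ⟦ M ⟧)))

  ⟦box⟧ : ∀ {Γ Δ τ} (Ns : S.Args Γ Δ) (M : S.Tm Δ τ) → ⟦ S.box Ns M ⟧ ≡ boxT Δ ⟦ Ns ⟧ᵃ (boxBody Δ ⟦ M ⟧ var)
  ⟦box⟧ {Δ = Δ} Ns M = cong lam (chain≡bindAll (map □† Δ) _ _ _ (λ ρ ys →
    cong₂ (λ Ns' b → app (var (ρ ze)) (box Ns' (lam b))) (ysArgs≡toArgs Δ ys) body≡))
    where
    zvars≡values : ∀ {Ξ} (Δ : Ctx A) (ρ : Ren (map K Δ) Ξ) → zvars Δ ρ ≡ values Δ (λ x → var (ρ x))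
    zvars≡values []      ρ = refl
    zvars≡values (a ∷ Δ) ρ = cong (var (ρ ze) ∷_) (zvars≡values Δ (λ x → ρ (su x)))
    body≡ : chain (map _† Δ) (zvars Δ su) (λ ρ' xs → app (ren (lookupAll xs) ⟦ M ⟧) (var (ρ' ze)))
            ≡ bindAll (map _† Δ) (values Δ (λ x → var (su x))) (kBody ⟦ M ⟧)
    body≡ = trans (chain≡bindAll (map _† Δ) (zvars Δ su) _ _ (λ ρ xs → cong (λ P → app P _)
              (trans (ren≡sub _ ⟦ M ⟧) (sub-cong (λ x → sym (env→sub-var xs x)) ⟦ M ⟧))))
              (cong (λ ts → bindAll (map _† Δ) ts (kBody ⟦ M ⟧)) (zvars≡values Δ su))

  sub-lamK : ∀ {Ξ Θ a b} (s : Sub Ξ Θ) (P : Tm (a ∷ Ξ) (Comp b)) → sub s (lamK P) ≡ lamK (sub (exts s) P)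
  sub-lamK s P = cong (λ P' → lam (lam (app P' (var (su ze))))) (begin
    sub (exts (exts s)) (ren (ext su) P)   ≡⟨ sub-ren _ (ext su) P ⟩
    sub (λ x → exts (exts s) (ext su x)) P ≡⟨ sub-cong (λ { ze → refl ; (su x) → wk-ren su (s x) }) P ⟩
    sub (λ x → ren (ext su) (exts s x)) P  ≡⟨ ren-sub (ext su) (exts s) P ⟨
    ren (ext su) (sub (exts s) P)          ∎)
    where open ≡-Reasoning

  sub-boxT : ∀ {Ξ Θ τ} (Δ : Ctx A) (s : Sub Ξ Θ) (ts : Comps Ξ (map □† Δ)) (B : Tm (map K Δ) (K τ)) →
             sub s (boxT Δ ts B) ≡ boxT Δ (All.map (sub s) ts) B
  sub-boxT Δ s ts B = cong lam (trans (sub-bindAll (map □† Δ) _ (kBox Δ B) (natural-kBox Δ B) (exts s))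
    (cong (λ ts' → bindAll (map □† Δ) ts' (kBox Δ B)) (trans (map-fuse (λ t → sym (wk-sub s t)) ts) (sym (map-∘ ts)))))

  -- Renaming, substitution and values

  return≈ : ∀ {Ξ B} {W W' : Tm Ξ B} → W ≈ W' → return W ≈ return W'
  return≈ W≈W' = lam≈ (appR≈ (ren≈ su W≈W'))

  lamK≈ : ∀ {Ξ a b} {P P' : Tm (a ∷ Ξ) (Comp b)} → P ≈ P' → lamK P ≈ lamK P'
  lamK≈ P≈P' = lam≈ (lam≈ (appL≈ (ren≈ (ext su) P≈P')))

  boxT≈ : ∀ {Ξ τ} (Δ : Ctx A) {ts ts' : Comps Ξ (map □† Δ)} (B : Tm (map K Δ) (K τ)) → ts ≈* ts' → boxT Δ ts B ≈ boxT Δ ts' B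
  boxT≈ Δ B ts≈ts' = lam≈ (bindAll-≈* (map □† Δ) (kBox Δ B) (≈*-ren su ts≈ts'))

  ren-lamK : ∀ {Ξ Θ a b} (ρ : Ren Ξ Θ) (P : Tm (a ∷ Ξ) (Comp b)) → ren ρ (lamK P) ≡ lamK (ren (ext ρ) P)
  ren-lamK ρ P = trans (ren≡sub ρ (lamK P)) (trans (sub-lamK _ P)
    (cong lamK (trans (sub-cong (λ { ze → refl ; (su x) → refl }) P) (sym (ren≡sub (ext ρ) P)))))

  ren-boxT : ∀ {Ξ Θ τ} (Δ : Ctx A) (ρ : Ren Ξ Θ) (ts : Comps Ξ (map □† Δ)) (B : Tm (map K Δ) (K τ)) →
             ren ρ (boxT Δ ts B) ≡ boxT Δ (All.map (ren ρ) ts) B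
  ren-boxT Δ ρ ts B = trans (ren≡sub ρ (boxT Δ ts B)) (trans (sub-boxT Δ _ ts B)
    (cong (λ ts' → boxT Δ ts' B) (map-cong ts (λ t → sym (ren≡sub ρ t)))))

  TracksRen : ∀ {Γ Δ} → Ren Γ Δ → Ren (ctx† Γ) (ctx† Δ) → Set
  TracksRen {Γ} ρ ρT = ∀ {τ} (x : Γ ∋ τ) → ρT (var† x) ≡ var† (ρ x)

  TracksSub : ∀ {Γ Δ} → S.Sub Γ Δ → Sub (ctx† Γ) (ctx† Δ) → Set
  TracksSub {Γ} s sT = ∀ {τ} (x : Γ ∋ τ) → ⟦ s x ⟧ ≈ return (sT (var† x))

  ⟦⟧-ren  : ∀ {Γ Δ σ} {ρ : Ren Γ Δ} {ρT : Ren (ctx† Γ) (ctx† Δ)} → TracksRen ρ ρT → (M : S.Tm Γ σ) → ⟦ S.ren ρ M ⟧ ≡ ren ρT ⟦ M ⟧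
  ⟦⟧ᵃ-ren : ∀ {Γ Δ Θ} {ρ : Ren Γ Δ} {ρT : Ren (ctx† Γ) (ctx† Δ)} → TracksRen ρ ρT → (Ns : S.Args Γ Θ) →
            ⟦ S.renA ρ Ns ⟧ᵃ ≡ All.map (ren ρT) ⟦ Ns ⟧ᵃ
  ⟦⟧-ren t (S.con c)    = refl
  ⟦⟧-ren t (S.var x)    = cong (λ y → lam (app (var ze) (var (su y)))) (sym (t x))
  ⟦⟧-ren {ρ = ρ} {ρT} t (S.lam M) = begin
    ⟦ S.lam (S.ren (ext ρ) M) ⟧         ≡⟨ ⟦lam⟧ (S.ren (ext ρ) M) ⟩
    return (lamK ⟦ S.ren (ext ρ) M ⟧)  ≡⟨ cong (λ P → return (lamK P)) (⟦⟧-ren text M) ⟩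
    return (lamK (ren (ext ρT) ⟦ M ⟧)) ≡⟨ cong return (ren-lamK ρT ⟦ M ⟧) ⟨
    return (ren ρT (lamK ⟦ M ⟧))       ≡⟨ ren-return ρT (lamK ⟦ M ⟧) ⟨
    ren ρT (return (lamK ⟦ M ⟧))       ≡⟨ cong (ren ρT) (⟦lam⟧ M) ⟨
    ren ρT ⟦ S.lam M ⟧                 ∎
    where
    open ≡-Reasoning
    text : TracksRen (ext ρ) (ext ρT)
    text ze     = refl
    text (su x) = cong su (t x)
  ⟦⟧-ren {ρT = ρT} t (S.app M N) =
    cong₂ (λ M' N' → lam (app M' (lam (app N' (app (var ze) (var (su ze)))))))
      (trans (cong wk (⟦⟧-ren t M)) (wk-ren ρT ⟦ M ⟧))
      (trans (cong (λ N' → wk (wk N')) (⟦⟧-ren t N)) (trans (cong wk (wk-ren ρT ⟦ N ⟧)) (wk-ren (ext ρT) (wk ⟦ N ⟧))))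
  ⟦⟧-ren {ρ = ρ} {ρT} t (S.box {Δ = Δ} Ns M) = begin
    ⟦ S.box (S.renA ρ Ns) M ⟧                   ≡⟨ ⟦box⟧ (S.renA ρ Ns) M ⟩
    boxT Δ ⟦ S.renA ρ Ns ⟧ᵃ B                   ≡⟨ cong (λ ts → boxT Δ ts B) (⟦⟧ᵃ-ren t Ns) ⟩
    boxT Δ (All.map (ren ρT) ⟦ Ns ⟧ᵃ) B         ≡⟨ ren-boxT Δ ρT ⟦ Ns ⟧ᵃ B ⟨
    ren ρT (boxT Δ ⟦ Ns ⟧ᵃ B)                   ≡⟨ cong (ren ρT) (⟦box⟧ Ns M) ⟨
    ren ρT ⟦ S.box Ns M ⟧                       ∎
    where
    open ≡-Reasoning
    B = boxBody Δ ⟦ M ⟧ var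
  ⟦⟧ᵃ-ren t S.[]       = refl
  ⟦⟧ᵃ-ren t (N S.∷ Ns) = cong₂ _∷_ (⟦⟧-ren t N) (⟦⟧ᵃ-ren t Ns)

  ⟦⟧-wk : ∀ {Γ σ τ} (M : S.Tm Γ σ) → ⟦ S.wk {τ = τ} M ⟧ ≡ wk ⟦ M ⟧
  ⟦⟧-wk = ⟦⟧-ren (λ x → refl)

  ⟦⟧-sub  : ∀ {Γ Δ σ} {s : S.Sub Γ Δ} {sT : Sub (ctx† Γ) (ctx† Δ)} → TracksSub s sT → (M : S.Tm Γ σ) → ⟦ S.sub s M ⟧ ≈ sub sT ⟦ M ⟧
  ⟦⟧ᵃ-sub : ∀ {Γ Δ Θ} {s : S.Sub Γ Δ} {sT : Sub (ctx† Γ) (ctx† Δ)} → TracksSub s sT → (Ns : S.Args Γ Θ) →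
            ⟦ S.subA s Ns ⟧ᵃ ≈* All.map (sub sT) ⟦ Ns ⟧ᵃ
  ⟦⟧-sub t (S.con c)    = ≈-refl
  ⟦⟧-sub t (S.var x)    = t x
  ⟦⟧-sub {s = s} {sT} t (S.lam M) = begin
    ⟦ S.lam (S.sub (S.exts s) M) ⟧        ≡⟨ ⟦lam⟧ (S.sub (S.exts s) M) ⟩
    return (lamK ⟦ S.sub (S.exts s) M ⟧) ≈⟨ return≈ (lamK≈ (⟦⟧-sub texts M)) ⟩
    return (lamK (sub (exts sT) ⟦ M ⟧))  ≡⟨ cong return (sub-lamK sT ⟦ M ⟧) ⟨
    return (sub sT (lamK ⟦ M ⟧))         ≡⟨ sub-return sT (lamK ⟦ M ⟧) ⟨
    sub sT (return (lamK ⟦ M ⟧))         ≡⟨ cong (sub sT) (⟦lam⟧ M) ⟨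
    sub sT ⟦ S.lam M ⟧                   ∎
    where
    open ≈-Reasoning
    texts : TracksSub (S.exts s) (exts sT)
    texts ze     = ≈-refl
    texts (su x) = ≈-trans (≡⇒≈ (⟦⟧-wk (s x))) (≈-trans (ren≈ su (t x)) (≡⇒≈ (ren-return su _)))
  ⟦⟧-sub {sT = sT} t (S.app M N) =
    ≈-trans (lam≈ (appL≈ (ren≈ su (⟦⟧-sub t M))))
      (≈-trans (lam≈ (appR≈ (lam≈ (appL≈ (ren≈ su (ren≈ su (⟦⟧-sub t N)))))))
        (≡⇒≈ (cong₂ (λ M' N' → lam (app M' (lam (app N' (app (var ze) (var (su ze)))))))
               (wk-sub sT ⟦ M ⟧) (trans (cong wk (wk-sub sT ⟦ N ⟧)) (wk-sub (exts sT) (wk ⟦ N ⟧))))))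
  ⟦⟧-sub {s = s} {sT} t (S.box {Δ = Δ} Ns M) = begin
    ⟦ S.box (S.subA s Ns) M ⟧                   ≡⟨ ⟦box⟧ (S.subA s Ns) M ⟩
    boxT Δ ⟦ S.subA s Ns ⟧ᵃ B                   ≈⟨ boxT≈ Δ B (⟦⟧ᵃ-sub t Ns) ⟩
    boxT Δ (All.map (sub sT) ⟦ Ns ⟧ᵃ) B         ≡⟨ sub-boxT Δ sT ⟦ Ns ⟧ᵃ B ⟨
    sub sT (boxT Δ ⟦ Ns ⟧ᵃ B)                   ≡⟨ cong (sub sT) (⟦box⟧ Ns M) ⟨
    sub sT ⟦ S.box Ns M ⟧                       ∎
    where
    open ≈-Reasoning
    B = boxBody Δ ⟦ M ⟧ var
  ⟦⟧ᵃ-sub t S.[]       = []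
  ⟦⟧ᵃ-sub t (N S.∷ Ns) = ⟦⟧-sub t N ∷ ⟦⟧ᵃ-sub t Ns

  ⟦⟧-value   : ∀ {Γ σ} {V : S.Tm Γ σ} → S.Value V → Σ (Tm (ctx† Γ) (σ †)) (λ W → ⟦ V ⟧ ≈ return W)
  ⟦⟧ᵃ-values : ∀ {Γ Δ} {Vs : S.Args Γ Δ} → S.ValArgs Vs → Σ (All (Tm (ctx† Γ)) (map □† Δ)) (⟦ Vs ⟧ᵃ ≈return*_)
  ⟦⟧-value (S.con {σ = σ} {c = c}) = con (σ , refl , c) , ≈-refl
  ⟦⟧-value (S.var {x = x})         = var (var† x) , ≈-refl
  ⟦⟧-value (S.lam {M = M})         = lamK ⟦ M ⟧ , ≡⇒≈ (⟦lam⟧ M)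
  ⟦⟧-value (S.box {Δ = Δ} {Ns = Vs} {M = M} vs) with ⟦⟧ᵃ-values vs
  ... | Ws , ⟦Vs⟧≈Ws = box (toArgs Δ Ws) B , (begin
    ⟦ S.box Vs M ⟧                                        ≡⟨ ⟦box⟧ Vs M ⟩
    boxT Δ ⟦ Vs ⟧ᵃ B                                      ≈⟨ lam≈ (bindAll-returns (map □† Δ) _ (natural-kBox Δ B) (≈return*-ren su ⟦Vs⟧≈Ws)) ⟩
    lam (app (var ze) (box (toArgs Δ (All.map wk Ws)) B)) ≡⟨ cong (λ Ns → lam (app (var ze) (box Ns B))) (renA-toArgs Δ su Ws) ⟨
    return (box (toArgs Δ Ws) B)                          ∎)
    where
    open ≈-Reasoning
    B = boxBody Δ ⟦ M ⟧ var
  ⟦⟧ᵃ-values S.[]       = [] , []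
  ⟦⟧ᵃ-values (v S.∷ vs) with ⟦⟧-value v | ⟦⟧ᵃ-values vs
  ... | W , ⟦V⟧≈W | Ws , ⟦Vs⟧≈Ws = W ∷ Ws , ⟦V⟧≈W ∷ ⟦Vs⟧≈Ws

  -- Application and the rules idβ, βv, ηv

  infixr 5 _∷ₛ_
  _∷ₛ_ : ∀ {Ξ Θ : Ctx A} {a} → Tm Θ a → Sub Ξ Θ → Sub (a ∷ Ξ) Θ
  (W ∷ₛ s) ze     = W
  (W ∷ₛ s) (su x) = s x

  replace₀ : ∀ {Ξ : Ctx A} {a b} → Tm (b ∷ Ξ) a → Sub (a ∷ Ξ) (b ∷ Ξ)
  replace₀ k = k ∷ₛ (λ x → var (su x))

  replace₀-wk : ∀ {Ξ : Ctx A} {a b c} (k : Tm (b ∷ Ξ) a) (M : Tm Ξ c) → sub (replace₀ k) (wk M) ≡ wk M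
  replace₀-wk k M = trans (sub-ren _ su M) (sym (ren≡sub su M))

  app-wk-lam : ∀ {Ξ a b c} (P : Tm Ξ (Comp a)) (Q : Tm (b ∷ Ξ) (a ⇒ atom R)) (k : Tm (c ∷ Ξ) b) →
               app (wk (lam (app (wk P) Q))) k ≈ app (wk P) (sub (replace₀ k) Q)
  app-wk-lam P Q k = ≈-trans β≈ (≡⇒≈ (cong₂ app wkP≡ Q≡))
    where
    wkP≡ = trans (sub-ren _ (ext su) (wk P)) (trans (sub-ren _ _ P) (sym (ren≡sub su P)))
    Q≡   = trans (sub-ren _ (ext su) Q) (sub-cong (λ { ze → refl ; (su x) → refl }) Q)

  lamK-app : ∀ {Ξ Θ a b} (ρ : Ren Ξ Θ) (P : Tm (a ∷ Ξ) (Comp b)) (k : Tm Θ (b ⇒ atom R)) (U : Tm Θ a) →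
             app (app (ren ρ (lamK P)) k) U ≈ app (sub (U ∷ₛ (λ x → var (ρ x))) P) k
  lamK-app ρ P k U = ≈-trans (appL≈ β≈) (≈-trans β≈ (≡⇒≈ (cong₂ app P≡ (sub-single-wk U k))))
    where
    P≡ = trans (sub-sub (single U) (exts (single k)) (ren (ext (ext ρ)) (ren (ext su) P)))
           (trans (cong (sub _) (ren-ren (ext (ext ρ)) (ext su) P))
           (trans (sub-ren _ _ P) (sub-cong (λ { ze → refl ; (su x) → refl }) P)))

  ⟦app⟧-returnL : ∀ {Γ σ τ} (M : S.Tm Γ (σ ⇒ τ)) (N : S.Tm Γ σ) W → ⟦ M ⟧ ≈ return W →
                  ⟦ S.app M N ⟧ ≈ lam (app (wk ⟦ N ⟧) (app (wk W) (var ze)))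
  ⟦app⟧-returnL M N W ⟦M⟧≈W = begin
    ⟦ S.app M N ⟧                                        ≡⟨⟩
    lam (app (wk ⟦ M ⟧) kN)                              ≈⟨ lam≈ (appL≈ (ren≈ su ⟦M⟧≈W)) ⟩
    lam (app (wk (return W)) kN)                         ≡⟨ cong (λ M' → lam (app M' kN)) (ren-return su W) ⟩
    lam (app (return (wk W)) kN)                         ≈⟨ lam≈ (return-app (wk W) kN) ⟩
    lam (app kN (wk W))                                  ≈⟨ lam≈ β≈ ⟩
    lam (app (wk (wk ⟦ N ⟧) [ wk W ]) (app (wk W) (var ze))) ≡⟨ cong (λ N' → lam (app N' (app (wk W) (var ze)))) (sub-single-wk (wk W) (wk ⟦ N ⟧)) ⟩
    lam (app (wk ⟦ N ⟧) (app (wk W) (var ze)))           ∎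
    where
    open ≈-Reasoning
    kN = lam (app (wk (wk ⟦ N ⟧)) (app (var ze) (var (su ze))))

  ⟦app⟧-return² : ∀ {Γ σ τ} (M : S.Tm Γ (σ ⇒ τ)) (N : S.Tm Γ σ) W U → ⟦ M ⟧ ≈ return W → ⟦ N ⟧ ≈ return U →
                  ⟦ S.app M N ⟧ ≈ lam (app (app (wk W) (var ze)) (wk U))
  ⟦app⟧-return² M N W U ⟦M⟧≈W ⟦N⟧≈U = begin
    ⟦ S.app M N ⟧                              ≈⟨ ⟦app⟧-returnL M N W ⟦M⟧≈W ⟩
    lam (app (wk ⟦ N ⟧) (app (wk W) (var ze)))  ≈⟨ lam≈ (appL≈ (ren≈ su ⟦N⟧≈U)) ⟩
    lam (app (wk (return U)) (app (wk W) (var ze))) ≡⟨ cong (λ N' → lam (app N' (app (wk W) (var ze)))) (ren-return su U) ⟩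
    lam (app (return (wk U)) (app (wk W) (var ze))) ≈⟨ lam≈ (return-app (wk U) (app (wk W) (var ze))) ⟩
    lam (app (app (wk W) (var ze)) (wk U))      ∎
    where open ≈-Reasoning

  app-wk-lamK : ∀ {Ξ a b c} (P : Tm (a ∷ Ξ) (Comp b)) (k : Tm (c ∷ Ξ) (b ⇒ atom R)) →
                app (wk (lamK P)) k ≈ lam (app (sub (var ze ∷ₛ (λ x → var (su (su x)))) P) (wk k))
  app-wk-lamK {Ξ} {a} {c = c} P k = begin
    app (wk (lamK P)) k                                        ≈⟨ η≈ _ ⟨
    lam (app (wk (app (wk (lamK P)) k)) (var ze))              ≡⟨ cong (λ L → lam (app (app L (wk k)) (var ze))) (ren-ren su su (lamK P)) ⟩
    lam (app (app (ren (λ x → su (su x)) (lamK P)) (wk k)) (var ze)) ≈⟨ lam≈ (lamK-app {Θ = a ∷ c ∷ Ξ} (λ x → su (su x)) P (wk k) (var ze)) ⟩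
    lam (app (sub (var ze ∷ₛ (λ x → var (su (su x)))) P) (wk k)) ∎
    where open ≈-Reasoning

  app-wk-lamK-id : ∀ {Γ σ b} (k : Tm (b ∷ ctx† Γ) (σ † ⇒ atom R)) → app (wk (lamK ⟦ S.var {Γ = σ ∷ Γ} ze ⟧)) k ≈ k
  app-wk-lamK-id k = begin
    app (wk (lamK ⟦ S.var ze ⟧)) k      ≈⟨ app-wk-lamK ⟦ S.var ze ⟧ k ⟩
    lam (app (return (var ze)) (wk k))  ≈⟨ lam≈ (return-app (var ze) (wk k)) ⟩
    lam (app (wk k) (var ze))           ≈⟨ η≈ k ⟩
    k                                   ∎
    where open ≈-Reasoning

  ⟦idβ⟧ : ∀ {Γ σ} (M : S.Tm Γ σ) → ⟦ S.app (S.lam (S.var ze)) M ⟧ ≈ ⟦ M ⟧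
  ⟦idβ⟧ M = begin
    ⟦ S.app (S.lam (S.var ze)) M ⟧                      ≈⟨ ⟦app⟧-returnL (S.lam (S.var ze)) M _ (≡⇒≈ (⟦lam⟧ (S.var ze))) ⟩
    lam (app (wk ⟦ M ⟧) (app (wk (lamK ⟦ S.var ze ⟧)) (var ze))) ≈⟨ lam≈ (appR≈ (app-wk-lamK-id (var ze))) ⟩
    lam (app (wk ⟦ M ⟧) (var ze))                       ≈⟨ η≈ ⟦ M ⟧ ⟩
    ⟦ M ⟧                                               ∎
    where open ≈-Reasoning

  ⟦βv⟧ : ∀ {Γ σ τ} (M : S.Tm (σ ∷ Γ) τ) {V : S.Tm Γ σ} → S.Value V → ⟦ S.app (S.lam M) V ⟧ ≈ ⟦ M S.[ V ] ⟧
  ⟦βv⟧ M {V} v with ⟦⟧-value v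
  ... | U , ⟦V⟧≈U = begin
    ⟦ S.app (S.lam M) V ⟧                                    ≈⟨ ⟦app⟧-return² (S.lam M) V _ U (≡⇒≈ (⟦lam⟧ M)) ⟦V⟧≈U ⟩
    lam (app (app (wk (lamK ⟦ M ⟧)) (var ze)) (wk U))        ≈⟨ lam≈ (lamK-app su ⟦ M ⟧ (var ze) (wk U)) ⟩
    lam (app (sub (wk U ∷ₛ (λ x → var (su x))) ⟦ M ⟧) (var ze)) ≡⟨ cong (λ P → lam (app P (var ze))) wk-sub-single ⟨
    lam (app (wk (⟦ M ⟧ [ U ])) (var ze))                    ≈⟨ η≈ _ ⟩
    ⟦ M ⟧ [ U ]                                              ≈⟨ ⟦⟧-sub tsingle M ⟨
    ⟦ M S.[ V ] ⟧                                            ∎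
    where
    open ≈-Reasoning
    tsingle : TracksSub (S.single V) (single U)
    tsingle ze     = ⟦V⟧≈U
    tsingle (su x) = ≈-refl
    wk-sub-single : wk (⟦ M ⟧ [ U ]) ≡ sub (wk U ∷ₛ (λ x → var (su x))) ⟦ M ⟧
    wk-sub-single = trans (ren-sub su (single U) ⟦ M ⟧) (sub-cong (λ { ze → refl ; (su x) → refl }) ⟦ M ⟧)

  ⟦ηv⟧ : ∀ {Γ σ τ} {V : S.Tm Γ (σ ⇒ τ)} → S.Value V → ⟦ S.lam (S.app (S.wk V) (S.var ze)) ⟧ ≈ ⟦ V ⟧
  ⟦ηv⟧ {V = V} v with ⟦⟧-value v
  ... | U , ⟦V⟧≈U = begin
    ⟦ S.lam (S.app (S.wk V) (S.var ze)) ⟧   ≡⟨ ⟦lam⟧ (S.app (S.wk V) (S.var ze)) ⟩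
    return (lamK ⟦ S.app (S.wk V) (S.var ze) ⟧) ≈⟨ return≈ lamK-body≈ ⟩
    return U                                 ≈⟨ ⟦V⟧≈U ⟨
    ⟦ V ⟧                                    ∎
    where
    open ≈-Reasoning
    ⟦wkV⟧≈wkU : ⟦ S.wk V ⟧ ≈ return (wk U)
    ⟦wkV⟧≈wkU = ≈-trans (≡⇒≈ (⟦⟧-wk V)) (≈-trans (ren≈ su ⟦V⟧≈U) (≡⇒≈ (ren-return su U)))
    wk²U = ren (ext (ext su)) (wk (wk U))
    wk²U≡ : sub (single (var (su ze))) wk²U ≡ wk (wk U)
    wk²U≡ = trans (sub-ren _ _ (wk (wk U))) (trans (sub-ren _ _ (wk U)) (trans (sub-ren _ _ U)
              (sym (trans (ren-ren su su U) (ren≡sub _ U)))))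
    lamK-body≈ : lamK ⟦ S.app (S.wk V) (S.var ze) ⟧ ≈ U
    lamK-body≈ = begin
      lamK ⟦ S.app (S.wk V) (S.var ze) ⟧                          ≈⟨ lamK≈ (⟦app⟧-return² (S.wk V) (S.var ze) (wk U) (var ze) ⟦wkV⟧≈wkU ≈-refl) ⟩
      lam (lam (app (lam (app (app wk²U (var ze)) (var (su ze)))) (var (su ze)))) ≈⟨ lam≈ (lam≈ β≈) ⟩
      lam (lam (app (app (sub (single (var (su ze))) wk²U) (var (su ze))) (var ze))) ≡⟨ cong (λ U' → lam (lam (app (app U' (var (su ze))) (var ze)))) wk²U≡ ⟩
      lam (lam (app (app (wk (wk U)) (var (su ze))) (var ze)))    ≈⟨ lam≈ (η≈ _) ⟩
      lam (app (wk U) (var ze))                                   ≈⟨ η≈ U ⟩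
      U                                                           ∎

  -- Frames and evaluation contexts

  ⟦++ᵃ⟧ : ∀ {Γ Δ X} (Ns : S.Args Γ Δ) (Ms : S.Args Γ X) → ⟦ Ns S.++ᵃ Ms ⟧ᵃ ≡ appendAll □† Δ ⟦ Ns ⟧ᵃ ⟦ Ms ⟧ᵃ
  ⟦++ᵃ⟧ S.[]       Ms = refl
  ⟦++ᵃ⟧ (N S.∷ Ns) Ms = cong (⟦ N ⟧ ∷_) (⟦++ᵃ⟧ Ns Ms)

  FrameVals : ∀ {Γ σ τ} → S.Frame Γ σ τ → Set
  FrameVals (S.appL M)                        = ⊤
  FrameVals {Γ} {σ} {τ} (S.appR V)            = Tm (ctx† Γ) ((σ ⇒ τ) †)
  FrameVals {Γ} (S.boxF {Δw = Δw} Ws Qs M)    = All (Tm (ctx† Γ)) (map □† Δw)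

  Returns : ∀ {Γ σ τ} (C : S.Frame Γ σ τ) → FrameVals C → Set
  Returns (S.appL M)      _  = ⊤
  Returns (S.appR V)      U  = ⟦ V ⟧ ≈ return U
  Returns (S.boxF Ws Qs M) Us = ⟦ Ws ⟧ᵃ ≈return* Us

  valid-returns : ∀ {Γ σ τ} (C : S.Frame Γ σ τ) → S.ValidF C → Σ (FrameVals C) (Returns C)
  valid-returns (S.appL M)      _  = tt , tt
  valid-returns (S.appR V)      v  = ⟦⟧-value v
  valid-returns (S.boxF Ws Qs M) vs = ⟦⟧ᵃ-values vs

  kBoxFrame : ∀ {Ξ τ} (Δw Δz : Ctx A) {ρ} (M : S.Tm (Δw ++ ρ ∷ Δz) τ) (Us : All (Tm Ξ) (map □† Δw)) →
              Cont ((□† τ ⇒ atom R) ∷ Ξ) (map □† (ρ ∷ Δz))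
  kBoxFrame Δw Δz {ρ} M Us = PrefixCont □† Δw (ρ ∷ Δz) (kBox (Δw ++ ρ ∷ Δz) (boxBody _ ⟦ M ⟧ var)) (All.map wk Us)

  natural-kBoxFrame : ∀ {Ξ τ} (Δw Δz : Ctx A) {ρ} (M : S.Tm (Δw ++ ρ ∷ Δz) τ) (Us : All (Tm Ξ) (map □† Δw)) →
                      Natural (kBoxFrame Δw Δz M Us)
  natural-kBoxFrame Δw Δz {ρ} M Us = natural-++ □† Δw (ρ ∷ Δz) (natural-kBox _ _) var (All.map wk Us)

  contF : ∀ {Γ σ τ} (C : S.Frame Γ σ τ) → FrameVals C → Tm ((τ † ⇒ atom R) ∷ ctx† Γ) (σ † ⇒ atom R)
  contF (S.appL M)     _  = lam (app (wk (wk ⟦ M ⟧)) (app (var ze) (var (su ze))))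
  contF (S.appR V)     U  = app (wk U) (var ze)
  contF (S.boxF {Δw = Δw} {Δz = Δz} Ws Qs M) Us =
    lam (bindAll (map □† Δz) (All.map wk (All.map wk ⟦ Qs ⟧ᵃ)) (λ s Ws' → kBoxFrame Δw Δz M Us (λ x → s (su x)) (s ze ∷ Ws')))

  ⟦plugF⟧ : ∀ {Γ σ τ} (C : S.Frame Γ σ τ) (w : FrameVals C) → Returns C w → (P : S.Tm Γ σ) →
            ⟦ S.plugF C P ⟧ ≈ lam (app (wk ⟦ P ⟧) (contF C w))
  ⟦plugF⟧ (S.appL M) w _ P = ≈-refl
  ⟦plugF⟧ (S.appR V) U ⟦V⟧≈U P = ⟦app⟧-returnL V P U ⟦V⟧≈U
  ⟦plugF⟧ (S.boxF {Δw = Δw} {Δz = Δz} {ρ = ρ} Ws Qs M) Us ⟦Ws⟧≈Us P = begin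
    ⟦ S.box (Ws S.++ᵃ (P S.∷ Qs)) M ⟧
      ≡⟨ trans (⟦box⟧ _ M) (cong (λ ts → lam (bindAll (map □† (Δw ++ ρ ∷ Δz)) ts (kBox _ B)))
           (trans (cong (All.map wk) (⟦++ᵃ⟧ Ws (P S.∷ Qs))) (map-appendAll □† wk Δw ⟦ Ws ⟧ᵃ (⟦ P ⟧ ∷ ⟦ Qs ⟧ᵃ)))) ⟩
    lam (bindAll (map □† (Δw ++ ρ ∷ Δz)) (appendAll □† Δw (All.map wk ⟦ Ws ⟧ᵃ) (All.map wk (⟦ P ⟧ ∷ ⟦ Qs ⟧ᵃ))) (kBox _ B))
      ≈⟨ lam≈ (bindAll-returns-prefix □† Δw (ρ ∷ Δz) _ (kBox _ B) (natural-kBox _ B) (≈return*-ren su ⟦Ws⟧≈Us)) ⟩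
    lam (app (wk ⟦ P ⟧) (contF (S.boxF Ws Qs M) Us)) ∎
    where
    open ≈-Reasoning
    B = boxBody (Δw ++ ρ ∷ Δz) ⟦ M ⟧ var

  module _ {Γ Δ : Ctx A} (ρ : Ren Γ Δ) (ρT : Ren (ctx† Γ) (ctx† Δ)) (t : TracksRen ρ ρT) where
    renVals : ∀ {σ τ} (C : S.Frame Γ σ τ) → FrameVals C → FrameVals (S.renF ρ C)
    renVals (S.appL M)      w  = tt
    renVals (S.appR V)      U  = ren ρT U
    renVals (S.boxF Ws Qs M) Us = All.map (ren ρT) Us

    ren-returns : ∀ {σ τ} (C : S.Frame Γ σ τ) (w : FrameVals C) → Returns C w → Returns (S.renF ρ C) (renVals C w)
    ren-returns (S.appL M)      w  _ = tt
    ren-returns (S.appR V)      U  ⟦V⟧≈U = ≈-trans (≡⇒≈ (⟦⟧-ren t V)) (≈-trans (ren≈ ρT ⟦V⟧≈U) (≡⇒≈ (ren-return ρT U)))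
    ren-returns (S.boxF Ws Qs M) Us ⟦Ws⟧≈Us =
      subst (_≈return* All.map (ren ρT) Us) (sym (⟦⟧ᵃ-ren t Ws)) (≈return*-ren ρT ⟦Ws⟧≈Us)

    contF-ren : ∀ {σ τ} (C : S.Frame Γ σ τ) (w : FrameVals C) → contF (S.renF ρ C) (renVals C w) ≡ ren (ext ρT) (contF C w)
    contF-ren (S.appL M) w = cong (λ M' → lam (app M' (app (var ze) (var (su ze)))))
      (trans (cong (λ M' → wk (wk M')) (⟦⟧-ren t M)) (trans (cong wk (wk-ren ρT ⟦ M ⟧)) (wk-ren (ext ρT) (wk ⟦ M ⟧))))
    contF-ren (S.appR V) U = cong (λ U' → app U' (var ze)) (wk-ren ρT U)
    contF-ren (S.boxF {Δw = Δw} {Δz = Δz} Ws Qs M) Us = cong lam (begin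
      bindAll (map □† Δz) (All.map wk (All.map wk ⟦ S.renA ρ Qs ⟧ᵃ)) _
        ≡⟨ cong (λ ts → bindAll (map □† Δz) ts _) ts≡ ⟩
      bindAll (map □† Δz) (All.map (sub ρ̂) (All.map wk (All.map wk ⟦ Qs ⟧ᵃ))) _
        ≡⟨ bindAll-cong (map □† Δz) _ k≡ ⟩
      bindAll (map □† Δz) (All.map (sub ρ̂) (All.map wk (All.map wk ⟦ Qs ⟧ᵃ))) _
        ≡⟨ sub-bindAll (map □† Δz) _ _ (natural-tail (natural-kBoxFrame Δw Δz M Us)) ρ̂ ⟨
      sub ρ̂ (bindAll (map □† Δz) (All.map wk (All.map wk ⟦ Qs ⟧ᵃ)) _)
        ≡⟨ ren≡sub (ext (ext ρT)) _ ⟨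
      ren (ext (ext ρT)) (bindAll (map □† Δz) (All.map wk (All.map wk ⟦ Qs ⟧ᵃ)) _) ∎)
      where
      open ≡-Reasoning
      ρ̂ : Sub _ _
      ρ̂ x = var (ext (ext ρT) x)
      ts≡ : All.map wk (All.map wk ⟦ S.renA ρ Qs ⟧ᵃ) ≡ All.map (sub ρ̂) (All.map wk (All.map wk ⟦ Qs ⟧ᵃ))
      ts≡ = trans (cong (λ ts → All.map wk (All.map wk ts)) (⟦⟧ᵃ-ren t Qs))
              (trans (map-fuse (λ _ → refl) _) (trans (map-fuse (λ q →
                trans (cong wk (wk-ren ρT q)) (trans (wk-ren (ext ρT) (wk q)) (ren≡sub _ (wk (wk q))))) _)
                (sym (trans (map-fuse (λ _ → refl) _) (map-∘ _)))))
      k≡ : ∀ {Θ} (s : Sub _ Θ) Ws' → kBoxFrame Δw Δz M (All.map (ren ρT) Us) (λ x → s (su x)) (s ze ∷ Ws')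
                                     ≡ kBoxFrame Δw Δz M Us (λ x → sub s (ρ̂ (su x))) (s ze ∷ Ws')
      k≡ s Ws' = cong (λ Us' → app (s (su ze)) (box (toArgs (Δw ++ _ ∷ Δz) (appendAll □† Δw Us' (s ze ∷ Ws'))) _))
        (trans (map-fuse (λ _ → refl) _) (trans (map-fuse (λ u →
          trans (sub-ren _ su (ren ρT u)) (trans (sub-ren _ ρT u) (sym (sub-ren _ su u)))) Us) (sym (map-∘ Us))))

  ECtxVals : ∀ {Γ σ τ} → S.ECtx Γ σ τ → Set
  ECtxVals S.hole    = ⊤
  ECtxVals (C S.· E) = FrameVals C × ECtxVals E

  ReturnsE : ∀ {Γ σ τ} (E : S.ECtx Γ σ τ) → ECtxVals E → Set
  ReturnsE S.hole    _        = ⊤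
  ReturnsE (C S.· E) (w , ws) = Returns C w × ReturnsE E ws

  valid-returnsE : ∀ {Γ σ τ} (E : S.ECtx Γ σ τ) → S.ValidE E → Σ (ECtxVals E) (ReturnsE E)
  valid-returnsE S.hole    _          = tt , tt
  valid-returnsE (C S.· E) (vC , vE) with valid-returns C vC | valid-returnsE E vE
  ... | w , rC | ws , rE = (w , ws) , (rC , rE)

  contE : ∀ {Γ σ τ} (E : S.ECtx Γ σ τ) → ECtxVals E → Tm ((τ † ⇒ atom R) ∷ ctx† Γ) (σ † ⇒ atom R)
  contE S.hole    _        = var ze
  contE (C S.· E) (w , ws) = sub (replace₀ (contF C w)) (contE E ws)

  ⟦plugE⟧ : ∀ {Γ σ τ} (E : S.ECtx Γ σ τ) (ws : ECtxVals E) → ReturnsE E ws → (P : S.Tm Γ σ) →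
            ⟦ S.plugE E P ⟧ ≈ lam (app (wk ⟦ P ⟧) (contE E ws))
  ⟦plugE⟧ S.hole    ws       r          P = ≈-sym (η≈ ⟦ P ⟧)
  ⟦plugE⟧ (C S.· E) (w , ws) (rC , rE) P = begin
    ⟦ S.plugF C (S.plugE E P) ⟧                                        ≈⟨ ⟦plugF⟧ C w rC (S.plugE E P) ⟩
    lam (app (wk ⟦ S.plugE E P ⟧) (contF C w))                          ≈⟨ lam≈ (appL≈ (ren≈ su (⟦plugE⟧ E ws rE P))) ⟩
    lam (app (wk (lam (app (wk ⟦ P ⟧) (contE E ws)))) (contF C w))      ≈⟨ lam≈ (app-wk-lam ⟦ P ⟧ (contE E ws) (contF C w)) ⟩
    lam (app (wk ⟦ P ⟧) (contE (C S.· E) (w , ws)))                     ∎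
    where open ≈-Reasoning

  module _ {Γ Δ : Ctx A} (ρ : Ren Γ Δ) (ρT : Ren (ctx† Γ) (ctx† Δ)) (t : TracksRen ρ ρT) where
    renValsE : ∀ {σ τ} (E : S.ECtx Γ σ τ) → ECtxVals E → ECtxVals (S.renE ρ E)
    renValsE S.hole    _        = tt
    renValsE (C S.· E) (w , ws) = renVals ρ ρT t C w , renValsE E ws

    ren-returnsE : ∀ {σ τ} (E : S.ECtx Γ σ τ) (ws : ECtxVals E) → ReturnsE E ws → ReturnsE (S.renE ρ E) (renValsE E ws)
    ren-returnsE S.hole    _        _         = tt
    ren-returnsE (C S.· E) (w , ws) (rC , rE) = ren-returns ρ ρT t C w rC , ren-returnsE E ws rE

    contE-ren : ∀ {σ τ} (E : S.ECtx Γ σ τ) (ws : ECtxVals E) → contE (S.renE ρ E) (renValsE E ws) ≡ ren (ext ρT) (contE E ws)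
    contE-ren S.hole    _        = refl
    contE-ren (C S.· E) (w , ws) = begin
      sub (replace₀ (contF (S.renF ρ C) (renVals ρ ρT t C w))) (contE (S.renE ρ E) (renValsE E ws))
        ≡⟨ cong₂ (λ k K → sub (replace₀ k) K) (contF-ren ρ ρT t C w) (contE-ren E ws) ⟩
      sub (replace₀ (ren (ext ρT) (contF C w))) (ren (ext ρT) (contE E ws))
        ≡⟨ sub-ren _ (ext ρT) (contE E ws) ⟩
      sub (λ x → replace₀ (ren (ext ρT) (contF C w)) (ext ρT x)) (contE E ws)
        ≡⟨ sub-cong (λ { ze → refl ; (su x) → refl }) (contE E ws) ⟩
      sub (λ x → ren (ext ρT) (replace₀ (contF C w) x)) (contE E ws)
        ≡⟨ ren-sub (ext ρT) _ (contE E ws) ⟨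
      ren (ext ρT) (sub (replace₀ (contF C w)) (contE E ws)) ∎
      where open ≡-Reasoning

  -- The let rules

  lamK-plugE : ∀ {Γ σ ρ τ} (E : S.ECtx Γ ρ τ) (ws : ECtxVals E) → ReturnsE E ws → (M : S.Tm (σ ∷ Γ) ρ) →
               app (wk (lamK ⟦ S.plugE (S.renE su E) M ⟧)) (var ze) ≈ app (wk (lamK ⟦ M ⟧)) (contE E ws)
  lamK-plugE {Γ} {σ} {ρ} {τ} E ws r M = begin
    app (wk (lamK ⟦ S.plugE E' M ⟧)) (var ze)                              ≈⟨ app-wk-lamK ⟦ S.plugE E' M ⟧ (var ze) ⟩
    lam (app (sub s ⟦ S.plugE E' M ⟧) (var (su ze)))                       ≈⟨ lam≈ (appL≈ (sub≈ s (⟦plugE⟧ E' ws' r' M))) ⟩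
    lam (app (sub s (lam (app (wk ⟦ M ⟧) (contE E' ws')))) (var (su ze)))   ≈⟨ lam≈ β≈ ⟩
    lam (sub (exts s) (app (wk ⟦ M ⟧) (contE E' ws')) [ var (su ze) ])     ≡⟨ cong lam (cong₂ app M≡ k≡) ⟩
    lam (app (sub s ⟦ M ⟧) (wk (contE E ws)))                              ≈⟨ app-wk-lamK ⟦ M ⟧ (contE E ws) ⟨
    app (wk (lamK ⟦ M ⟧)) (contE E ws)                                     ∎
    where
    open ≈-Reasoning
    E'  = S.renE su E
    ws' = renValsE su su (λ x → refl) E ws
    r'  = ren-returnsE su su (λ x → refl) E ws r
    s : Sub (σ † ∷ ctx† Γ) (σ † ∷ (τ † ⇒ atom R) ∷ ctx† Γ)
    s = var ze ∷ₛ (λ x → var (su (su x)))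
    M≡ : sub (exts s) (wk ⟦ M ⟧) [ var (su ze) ] ≡ sub s ⟦ M ⟧
    M≡ = trans (sub-sub _ (exts s) (wk ⟦ M ⟧)) (trans (sub-ren _ su ⟦ M ⟧) (sub-cong (λ { ze → refl ; (su x) → refl }) ⟦ M ⟧))
    k≡ : sub (exts s) (contE E' ws') [ var (su ze) ] ≡ wk (contE E ws)
    k≡ = trans (cong (λ k → sub (exts s) k [ var (su ze) ]) (contE-ren su su (λ x → refl) E ws))
           (trans (sub-sub _ (exts s) (ren (ext su) (contE E ws)))
           (trans (sub-ren _ (ext su) (contE E ws))
           (trans (sub-cong (λ { ze → refl ; (su x) → refl }) (contE E ws)) (sym (ren≡sub su (contE E ws))))))

  ⟦letC⟧ : ∀ {Γ σ τ υ} (C : S.Frame Γ τ υ) → S.ValidF C → (M : S.Tm (σ ∷ Γ) τ) (N : S.Tm Γ σ) →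
           ⟦ S.plugF C (S.app (S.lam M) N) ⟧ ≈ ⟦ S.app (S.lam (S.plugF (S.renF su C) M)) N ⟧
  ⟦letC⟧ C vC M N with valid-returns C vC
  ... | w , rC = begin
    ⟦ S.plugF C (S.app (S.lam M) N) ⟧
      ≈⟨ ⟦plugF⟧ C w rC _ ⟩
    lam (app (wk ⟦ S.app (S.lam M) N ⟧) k)
      ≈⟨ lam≈ (appL≈ (ren≈ su (⟦app⟧-returnL (S.lam M) N _ (≡⇒≈ (⟦lam⟧ M))))) ⟩
    lam (app (wk (lam (app (wk ⟦ N ⟧) (app (wk (lamK ⟦ M ⟧)) (var ze))))) k)
      ≈⟨ lam≈ (app-wk-lam ⟦ N ⟧ _ k) ⟩
    lam (app (wk ⟦ N ⟧) (app (sub (replace₀ k) (wk (lamK ⟦ M ⟧))) k))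
      ≡⟨ cong (λ L → lam (app (wk ⟦ N ⟧) (app L k))) (replace₀-wk k (lamK ⟦ M ⟧)) ⟩
    lam (app (wk ⟦ N ⟧) (app (wk (lamK ⟦ M ⟧)) k))
      ≈⟨ lam≈ (appR≈ (lamK-plugE (C S.· S.hole) (w , tt) (rC , tt) M)) ⟨
    lam (app (wk ⟦ N ⟧) (app (wk (lamK ⟦ CM ⟧)) (var ze)))
      ≈⟨ ⟦app⟧-returnL (S.lam CM) N _ (≡⇒≈ (⟦lam⟧ CM)) ⟨
    ⟦ S.app (S.lam CM) N ⟧ ∎
    where
    open ≈-Reasoning
    k  = contF C w
    CM = S.plugF (S.renF su C) M

  ⟦letV⟧ : ∀ {Γ σ τ υ} (C : S.Frame Γ τ υ) → S.ValidF C → (y : Γ ∋ σ ⇒ τ) (M : S.Tm Γ σ) →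
           ⟦ S.plugF C (S.app (S.var y) M) ⟧ ≈ ⟦ S.app (S.lam (S.plugF (S.renF su C) (S.var ze))) (S.app (S.var y) M) ⟧
  ⟦letV⟧ C vC y M with valid-returns C vC
  ... | w , rC = begin
    ⟦ S.plugF C yM ⟧
      ≈⟨ ⟦plugF⟧ C w rC yM ⟩
    lam (app (wk ⟦ yM ⟧) (contF C w))
      ≈⟨ lam≈ (appR≈ (app-wk-lamK-id (contF C w))) ⟨
    lam (app (wk ⟦ yM ⟧) (app (wk (lamK ⟦ S.var ze ⟧)) (contF C w)))
      ≈⟨ lam≈ (appR≈ (lamK-plugE (C S.· S.hole) (w , tt) (rC , tt) (S.var ze))) ⟨
    lam (app (wk ⟦ yM ⟧) (app (wk (lamK ⟦ Cx ⟧)) (var ze)))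
      ≈⟨ ⟦app⟧-returnL (S.lam Cx) yM _ (≡⇒≈ (⟦lam⟧ Cx)) ⟨
    ⟦ S.app (S.lam Cx) yM ⟧ ∎
    where
    open ≈-Reasoning
    yM = S.app (S.var y) M
    Cx = S.plugF (S.renF su C) (S.var ze)

  app-wk-lamK-var : ∀ {Γ σ τ b} (y : Γ ∋ σ ⇒ τ) (k : Tm (b ∷ ctx† Γ) (τ † ⇒ atom R)) →
                    app (wk (lamK ⟦ S.app (S.var (su y)) (S.var ze) ⟧)) k ≈ app (var (su (var† y))) k
  app-wk-lamK-var {Γ} {σ} {τ} {b} y k = begin
    app (wk (lamK ⟦ yx ⟧)) k                                  ≈⟨ app-wk-lamK ⟦ yx ⟧ k ⟩
    lam (app (sub s ⟦ yx ⟧) (wk k))                            ≈⟨ lam≈ (appL≈ (sub≈ s (⟦app⟧-return² (S.var (su y)) (S.var ze) _ _ ≈-refl ≈-refl))) ⟩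
    lam (app (lam (app (app (var (su (su (su (var† y))))) (var ze)) (var (su ze)))) (wk k)) ≈⟨ lam≈ β≈ ⟩
    lam (app (app (var (su (su (var† y)))) (wk k)) (var ze))  ≈⟨ η≈ _ ⟩
    app (var (su (var† y))) k                                  ∎
    where
    open ≈-Reasoning
    yx = S.app (S.var (su y)) (S.var ze)
    s : Sub (σ † ∷ ctx† Γ) (σ † ∷ b ∷ ctx† Γ)
    s = var ze ∷ₛ (λ x → var (su (su x)))

  ⟦letE⟧ : ∀ {Γ σ τ υ} (E : S.ECtx Γ τ υ) → S.ValidE E → (y : Γ ∋ σ ⇒ τ) (M : S.Tm Γ σ) →
           ⟦ S.app (S.lam (S.plugE (S.renE su E) (S.app (S.var (su y)) (S.var ze)))) M ⟧ ≈ ⟦ S.plugE E (S.app (S.var y) M) ⟧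
  ⟦letE⟧ E vE y M with valid-returnsE E vE
  ... | ws , rE = begin
    ⟦ S.app (S.lam Eyx) M ⟧
      ≈⟨ ⟦app⟧-returnL (S.lam Eyx) M _ (≡⇒≈ (⟦lam⟧ Eyx)) ⟩
    lam (app (wk ⟦ M ⟧) (app (wk (lamK ⟦ Eyx ⟧)) (var ze)))
      ≈⟨ lam≈ (appR≈ (lamK-plugE E ws rE (S.app (S.var (su y)) (S.var ze)))) ⟩
    lam (app (wk ⟦ M ⟧) (app (wk (lamK ⟦ S.app (S.var (su y)) (S.var ze) ⟧)) k))
      ≈⟨ lam≈ (appR≈ (app-wk-lamK-var y k)) ⟩
    lam (app (wk ⟦ M ⟧) (app (var (su (var† y))) k))
      ≈⟨ lam≈ (app-wk-lam ⟦ M ⟧ (app (var (su (var† y))) (var ze)) k) ⟨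
    lam (app (wk (lam (app (wk ⟦ M ⟧) (app (var (su (var† y))) (var ze))))) k)
      ≈⟨ lam≈ (appL≈ (ren≈ su (⟦app⟧-returnL (S.var y) M (var (var† y)) ≈-refl))) ⟨
    lam (app (wk ⟦ S.app (S.var y) M ⟧) k)
      ≈⟨ ⟦plugE⟧ E ws rE (S.app (S.var y) M) ⟨
    ⟦ S.plugE E (S.app (S.var y) M) ⟧ ∎
    where
    open ≈-Reasoning
    Eyx = S.plugE (S.renE su E) (S.app (S.var (su y)) (S.var ze))
    k   = contE E ws

  -- Splitting translated contexts

  -- map K (Δ ++ X) and map K Δ ++ map K X are only propositionally equal, so the
  -- target □□ rule is applied to translated argument lists through casts.
  cast∋ : ∀ {Ω Ω' : Ctx A} {a} → Ω ≡ Ω' → Ω ∋ a → Ω' ∋ a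
  cast∋ refl x = x

  castTm : ∀ {Ω Ω' : Ctx A} {a} → Ω ≡ Ω' → Tm Ω a → Tm Ω' a
  castTm refl M = M

  castArgs : ∀ {Θ Ω Ω' : Ctx A} → Ω ≡ Ω' → Args Θ Ω → Args Θ Ω'
  castArgs refl Ns = Ns

  box-cast : ∀ {Θ Ω Ω' : Ctx A} {a} (e : Ω ≡ Ω') (Ns : Args Θ Ω) (M : Tm Ω a) → box Ns M ≡ box (castArgs e Ns) (castTm e M)
  box-cast refl Ns M = refl

  castTm≡ren : ∀ {Ω Ω' : Ctx A} {a} (e : Ω ≡ Ω') (M : Tm Ω a) → castTm e M ≡ ren (cast∋ e) M
  castTm≡ren refl M = sym (ren-id M)

  cast∋-sym-cast∋ : ∀ {Ω Ω' : Ctx A} {a} (e : Ω ≡ Ω') (x : Ω ∋ a) → cast∋ (sym e) (cast∋ e x) ≡ x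
  cast∋-sym-cast∋ refl x = refl

  cast∋-cast∋-sym : ∀ {Ω Ω' : Ctx A} {a} (e : Ω ≡ Ω') (x : Ω' ∋ a) → cast∋ e (cast∋ (sym e) x) ≡ x
  cast∋-cast∋-sym refl x = refl

  cast∋-trans : ∀ {Ω Ω' Ω'' : Ctx A} {a} (e : Ω ≡ Ω') (e' : Ω' ≡ Ω'') (x : Ω ∋ a) → cast∋ (trans e e') x ≡ cast∋ e' (cast∋ e x)
  cast∋-trans refl e' x = refl

  cast∋-ze : ∀ {Ω Ω' : Ctx A} {b} (e : Ω ≡ Ω') → cast∋ (cong (b ∷_) e) ze ≡ ze
  cast∋-ze refl = refl

  cast∋-su : ∀ {Ω Ω' : Ctx A} {a b} (e : Ω ≡ Ω') (x : Ω ∋ a) → cast∋ (cong (b ∷_) e) (su x) ≡ su (cast∋ e x)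
  cast∋-su refl x = refl

  cast∋-injL : ∀ (L : Ctx A) {Ω Ω' : Ctx A} {a} (e : Ω ≡ Ω') (x : L ∋ a) → cast∋ (cong (L ++_) e) (injL x) ≡ injL x
  cast∋-injL L refl x = refl

  cast∋-raise : ∀ (L : Ctx A) {Ω Ω' : Ctx A} {a} (e : Ω ≡ Ω') (x : Ω ∋ a) → cast∋ (cong (L ++_) e) (raise L x) ≡ raise L (cast∋ e x)
  cast∋-raise L refl x = refl

  castArgs-∷ : ∀ {Θ Ω Ω' : Ctx A} {b} (e : Ω ≡ Ω') (N : Tm Θ (□ b)) (Ns : Args Θ Ω) → castArgs (cong (b ∷_) e) (N ∷ Ns) ≡ N ∷ castArgs e Ns
  castArgs-∷ refl N Ns = refl

  castArgs-trans : ∀ {Θ Ω Ω' Ω'' : Ctx A} (e : Ω ≡ Ω') (e' : Ω' ≡ Ω'') (Ns : Args Θ Ω) →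
                   castArgs (trans e e') Ns ≡ castArgs e' (castArgs e Ns)
  castArgs-trans refl e' Ns = refl

  castArgs-++ : ∀ {Θ} (L : Ctx A) {Ω Ω' : Ctx A} (e : Ω ≡ Ω') (Ls : Args Θ L) (Ns : Args Θ Ω) →
                castArgs (cong (L ++_) e) (Ls ++ᵃ Ns) ≡ Ls ++ᵃ castArgs e Ns
  castArgs-++ L refl Ls Ns = refl

  injLᵐ : ∀ (f : Ty A → Ty A) (Δ : Ctx A) {X a} → map f Δ ∋ a → map f (Δ ++ X) ∋ a
  injLᵐ f (b ∷ Δ) ze     = ze
  injLᵐ f (b ∷ Δ) (su x) = su (injLᵐ f Δ x)

  raiseᵐ : ∀ (f : Ty A → Ty A) (Δ : Ctx A) {X a} → map f X ∋ a → map f (Δ ++ X) ∋ a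
  raiseᵐ f []      x = x
  raiseᵐ f (b ∷ Δ) x = su (raiseᵐ f Δ x)

  cast∋-injLᵐ : ∀ (f : Ty A → Ty A) (Δ X : Ctx A) {a} (x : map f Δ ∋ a) → cast∋ (map-++ f Δ X) (injLᵐ f Δ x) ≡ injL x
  cast∋-injLᵐ f (b ∷ Δ) X ze     = cast∋-ze (map-++ f Δ X)
  cast∋-injLᵐ f (b ∷ Δ) X (su x) = trans (cast∋-su (map-++ f Δ X) (injLᵐ f Δ x)) (cong su (cast∋-injLᵐ f Δ X x))

  cast∋-raiseᵐ : ∀ (f : Ty A → Ty A) (Δ X : Ctx A) {a} (x : map f X ∋ a) → cast∋ (map-++ f Δ X) (raiseᵐ f Δ x) ≡ raise (map f Δ) x
  cast∋-raiseᵐ f []      X x = refl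
  cast∋-raiseᵐ f (b ∷ Δ) X x = trans (cast∋-su (map-++ f Δ X) (raiseᵐ f Δ x)) (cong su (cast∋-raiseᵐ f Δ X x))

  toArgs-appendAll : ∀ {Θ} (Δ X : Ctx A) (Us : All (Tm Θ) (map □† Δ)) (Ws : All (Tm Θ) (map □† X)) →
                     castArgs (map-++ K Δ X) (toArgs (Δ ++ X) (appendAll □† Δ Us Ws)) ≡ toArgs Δ Us ++ᵃ toArgs X Ws
  toArgs-appendAll []      X []       Ws = refl
  toArgs-appendAll (b ∷ Δ) X (U ∷ Us) Ws = trans (castArgs-∷ (map-++ K Δ X) U _) (cong (U ∷_) (toArgs-appendAll Δ X Us Ws))

  boxSub-injL : ∀ {Ly Lz : Ctx A} {ρ} (L : Ctx A) (N : Tm Ly ρ) {a} (x : L ∋ a) → boxSub L {Δz = Lz} N (injL x) ≡ var (injL x)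
  boxSub-injL (b ∷ L) N ze     = refl
  boxSub-injL (b ∷ L) N (su x) = cong wk (boxSub-injL L N x)

  boxSub-hole : ∀ {Ly Lz : Ctx A} {ρ} (L : Ctx A) (N : Tm Ly ρ) → boxSub L {Δz = Lz} N (raise L ze) ≡ ren (λ y → raise L (injL y)) N
  boxSub-hole []      N = refl
  boxSub-hole (b ∷ L) N = trans (cong wk (boxSub-hole L N)) (ren-ren su _ N)

  boxSub-raise : ∀ {Ly Lz : Ctx A} {ρ} (L : Ctx A) (N : Tm Ly ρ) {a} (x : Lz ∋ a) → boxSub L {Δz = Lz} N (raise L (su x)) ≡ var (raise L (raise Ly x))
  boxSub-raise []      N x = refl
  boxSub-raise (b ∷ L) N x = cong wk (boxSub-raise L N x)

  module BoxBox (Δw Δy Δz : Ctx A) (ρ : Ty A) where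
    Ω  = Δw ++ ρ ∷ Δz
    Ω' = Δw ++ Δy ++ Δz

    splitΩ : map K Ω ≡ map K Δw ++ K ρ ∷ map K Δz
    splitΩ = map-++ K Δw (ρ ∷ Δz)

    splitΩ' : map K Ω' ≡ map K Δw ++ map K Δy ++ map K Δz
    splitΩ' = trans (map-++ K Δw (Δy ++ Δz)) (cong (map K Δw ++_) (map-++ K Δy Δz))

    boxSubK : Tm (map K Δy) (K ρ) → Sub (map K Ω) (map K Ω')
    boxSubK B x = ren (cast∋ (sym splitΩ')) (boxSub (map K Δw) B (cast∋ splitΩ x))

    private
      split-injLᵐ : ∀ {a} (x : map K Δw ∋ a) → cast∋ splitΩ' (injLᵐ K Δw x) ≡ injL x
      split-injLᵐ x = trans (cast∋-trans (map-++ K Δw (Δy ++ Δz)) _ (injLᵐ K Δw x))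
        (trans (cong (cast∋ _) (cast∋-injLᵐ K Δw (Δy ++ Δz) x)) (cast∋-injL (map K Δw) (map-++ K Δy Δz) x))

      split-middle : ∀ {a} (y : map K Δy ∋ a) → cast∋ splitΩ' (raiseᵐ K Δw (injLᵐ K Δy y)) ≡ raise (map K Δw) (injL y)
      split-middle y = trans (cast∋-trans (map-++ K Δw (Δy ++ Δz)) _ _)
        (trans (cong (cast∋ _) (cast∋-raiseᵐ K Δw (Δy ++ Δz) _))
        (trans (cast∋-raise (map K Δw) (map-++ K Δy Δz) _) (cong (raise (map K Δw)) (cast∋-injLᵐ K Δy Δz y))))

      split-right : ∀ {a} (z : map K Δz ∋ a) → cast∋ splitΩ' (raiseᵐ K Δw (raiseᵐ K Δy z)) ≡ raise (map K Δw) (raise (map K Δy) z)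
      split-right z = trans (cast∋-trans (map-++ K Δw (Δy ++ Δz)) _ _)
        (trans (cong (cast∋ _) (cast∋-raiseᵐ K Δw (Δy ++ Δz) _))
        (trans (cast∋-raise (map K Δw) (map-++ K Δy Δz) _) (cong (raise (map K Δw)) (cast∋-raiseᵐ K Δy Δz z))))

      unsplit : ∀ {a} {x : map K Ω' ∋ a} {y} → cast∋ splitΩ' x ≡ y → cast∋ (sym splitΩ') y ≡ x
      unsplit {x = x} refl = cast∋-sym-cast∋ splitΩ' x

    boxSubK-left : ∀ B {a} (x : map K Δw ∋ a) → boxSubK B (injLᵐ K Δw x) ≡ var (injLᵐ K Δw x)
    boxSubK-left B x = trans (cong (λ y → ren (cast∋ (sym splitΩ')) (boxSub (map K Δw) B y)) (cast∋-injLᵐ K Δw (ρ ∷ Δz) x))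
      (trans (cong (ren (cast∋ (sym splitΩ'))) (boxSub-injL (map K Δw) B x)) (cong var (unsplit (split-injLᵐ x))))

    boxSubK-hole : ∀ B → boxSubK B (raiseᵐ K Δw {X = ρ ∷ Δz} ze) ≡ ren (λ y → raiseᵐ K Δw (injLᵐ K Δy y)) B
    boxSubK-hole B = trans (cong (λ y → ren (cast∋ (sym splitΩ')) (boxSub (map K Δw) B y)) (cast∋-raiseᵐ K Δw (ρ ∷ Δz) ze))
      (trans (cong (ren (cast∋ (sym splitΩ'))) (boxSub-hole (map K Δw) B))
      (trans (ren-ren _ _ B) (ren-cong (λ y → unsplit (split-middle y)) B)))

    boxSubK-right : ∀ B {a} (z : map K Δz ∋ a) → boxSubK B (raiseᵐ K Δw {X = ρ ∷ Δz} (su z)) ≡ var (raiseᵐ K Δw (raiseᵐ K Δy z))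
    boxSubK-right B z = trans (cong (λ y → ren (cast∋ (sym splitΩ')) (boxSub (map K Δw) B y)) (cast∋-raiseᵐ K Δw (ρ ∷ Δz) (su z)))
      (trans (cong (ren (cast∋ (sym splitΩ'))) (boxSub-raise (map K Δw) B z)) (cong var (unsplit (split-right z))))

    □□-toArgs : ∀ {Θ τ} (Us : All (Tm Θ) (map □† Δw)) (Ls : All (Tm Θ) (map □† Δy)) (Qs : All (Tm Θ) (map □† Δz))
                (B : Tm (map K Δy) (K ρ)) (M : Tm (map K Ω) (K τ)) →
                box (toArgs Ω (appendAll □† Δw Us (box (toArgs Δy Ls) B ∷ Qs))) M ⟶
                box (toArgs Ω' (appendAll □† Δw Us (appendAll □† Δy Ls Qs))) (sub (boxSubK B) M)
    □□-toArgs Us Ls Qs B M = subst₂ _⟶_ (sym lhs≡) (sym rhs≡) (base □□)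
      where
      lhs≡ : box (toArgs Ω (appendAll □† Δw Us (box (toArgs Δy Ls) B ∷ Qs))) M ≡
             box (toArgs Δw Us ++ᵃ (box (toArgs Δy Ls) B ∷ toArgs Δz Qs)) (castTm splitΩ M)
      lhs≡ = trans (box-cast splitΩ _ M) (cong (λ Ns → box Ns (castTm splitΩ M)) (toArgs-appendAll Δw (ρ ∷ Δz) Us _))
      args≡ : castArgs splitΩ' (toArgs Ω' (appendAll □† Δw Us (appendAll □† Δy Ls Qs))) ≡ toArgs Δw Us ++ᵃ (toArgs Δy Ls ++ᵃ toArgs Δz Qs)
      args≡ = trans (castArgs-trans (map-++ K Δw (Δy ++ Δz)) _ _)
        (trans (cong (castArgs _) (toArgs-appendAll Δw (Δy ++ Δz) Us _))
        (trans (castArgs-++ (map K Δw) (map-++ K Δy Δz) _ _) (cong (toArgs Δw Us ++ᵃ_) (toArgs-appendAll Δy Δz Ls Qs))))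
      body≡ : castTm splitΩ' (sub (boxSubK B) M) ≡ sub (boxSub (map K Δw) B) (castTm splitΩ M)
      body≡ = trans (castTm≡ren splitΩ' _) (trans (ren-sub _ _ M) (trans (sub-cong (λ x →
        trans (ren-ren _ _ _) (trans (ren-cong (cast∋-cast∋-sym splitΩ') _) (ren-id _))) M)
        (trans (sym (sub-ren _ _ M)) (cong (sub _) (sym (castTm≡ren splitΩ M))))))
      rhs≡ : box (toArgs Ω' (appendAll □† Δw Us (appendAll □† Δy Ls Qs))) (sub (boxSubK B) M) ≡
             box (toArgs Δw Us ++ᵃ (toArgs Δy Ls ++ᵃ toArgs Δz Qs)) (sub (boxSub (map K Δw) B) (castTm splitΩ M))
      rhs≡ = trans (box-cast splitΩ' _ _) (cong₂ box args≡ body≡)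

  -- Inlining boxes and box bodies

  map-values : ∀ {Ξ Θ} (Δ : Ctx A) (f : ∀ {B} → Tm Ξ B → Tm Θ B) (g : Sub (map K Δ) Ξ) →
               All.map f (values Δ g) ≡ values Δ (λ x → f (g x))
  map-values []      f g = refl
  map-values (a ∷ Δ) f g = cong (f (g ze) ∷_) (map-values Δ f (λ x → g (su x)))

  values-cong : ∀ {Ξ} (Δ : Ctx A) {g₁ g₂ : Sub (map K Δ) Ξ} → g₁ ≗s g₂ → values Δ g₁ ≡ values Δ g₂
  values-cong []      e = refl
  values-cong (a ∷ Δ) e = cong₂ _∷_ (e ze) (values-cong Δ (λ x → e (su x)))

  values-++ : ∀ {Ξ} (Δ X : Ctx A) (g : Sub (map K (Δ ++ X)) Ξ) →
              values (Δ ++ X) g ≡ appendAll _† Δ (values Δ (λ x → g (injLᵐ K Δ x))) (values X (λ x → g (raiseᵐ K Δ x)))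
  values-++ []      X g = refl
  values-++ (a ∷ Δ) X g = cong (g ze ∷_) (values-++ Δ X (λ x → g (su x)))

  sub-boxBody : ∀ {Ξ Θ τ} (Δ : Ctx A) (P : Tm (ctx† Δ) (K τ)) (g : Sub (map K Δ) Ξ) (s : Sub Ξ Θ) →
                sub s (boxBody Δ P g) ≡ boxBody Δ P (λ x → sub s (g x))
  sub-boxBody Δ P g s = cong lam (trans (sub-bindAll (map _† Δ) _ (kBody P) (natural-kBody P) (exts s))
    (trans (cong (λ ts → bindAll (map _† Δ) ts _) (trans (map-values Δ (sub (exts s)) _) (values-cong Δ (λ x → sym (wk-sub s (g x))))))
           (bindAll-cong (map _† Δ) _ (λ s' Ws → refl))))

  bindAll-tail-[] : ∀ {Ξ Θ B Bs} (ts : Comps Ξ Bs) (k : Cont Ξ (B ∷ Bs)) → Natural k → (s : Sub Ξ Θ) (W : Tm Θ B) →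
    sub (exts s) (bindAll Bs (All.map wk ts) (λ s' Ws → k (λ x → s' (su x)) (s' ze ∷ Ws))) [ W ] ≡
    bindAll Bs (All.map (sub s) ts) (λ s' Ws → k (λ x → sub s' (s x)) (sub s' W ∷ Ws))
  bindAll-tail-[] {Ξ} {Θ} {B} {Bs} ts k n s W = begin
    sub (single W) (sub (exts s) (bindAll Bs (All.map wk ts) kTail))
      ≡⟨ sub-sub (single W) (exts s) (bindAll Bs (All.map wk ts) kTail) ⟩
    sub s' (bindAll Bs (All.map wk ts) kTail)
      ≡⟨ sub-bindAll Bs (All.map wk ts) kTail (natural-tail n) s' ⟩
    bindAll Bs (All.map (sub s') (All.map wk ts)) _
      ≡⟨ cong (λ ts' → bindAll Bs ts' _) (map-fuse (λ t → trans (sub-ren s' su t) (sub-cong (λ x → sub-single-wk W (s x)) t)) ts) ⟩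
    bindAll Bs (All.map (sub s) ts) _
      ≡⟨ bindAll-cong Bs _ (λ s'' Ws → resp-≗s n _ (λ x → cong (sub s'') (sub-single-wk W (s x)))) ⟩
    bindAll Bs (All.map (sub s) ts) _ ∎
    where
    open ≡-Reasoning
    kTail : Cont (B ∷ Ξ) Bs
    kTail s'' Ws = k (λ x → s'' (su x)) (s'' ze ∷ Ws)
    s' : Sub (B ∷ Ξ) Θ
    s' x = sub (single W) (exts s x)

  bindAll-boxBody : ∀ {Ξ ρ Bs} (Δ : Ctx A) (P : Tm (ctx† Δ) (K ρ)) (U : Tm (ctx† Δ) (ρ †)) → P ≈ return U →
    (g : Sub (map K Δ) Ξ) (ts : Comps Ξ Bs) (k : Cont Ξ (ρ † ∷ Bs)) → Natural k →
    bindAll (ρ † ∷ Bs) (boxBody Δ P g ∷ ts) k ≈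
    bindAll (map _† Δ) (values Δ g) (λ s Ws → bindAll Bs (All.map (sub s) ts)
      (λ s' Ws' → k (λ x → sub s' (s x)) (sub (env→sub (All.map (sub s') Ws)) U ∷ Ws')))
  bindAll-boxBody {Ξ} {ρ} {Bs} Δ P U P≈U g ts k n =
    ≈-trans β≈
    (≈-trans (≡⇒≈ (trans (sub-bindAll (map _† Δ) _ (kBody P) (natural-kBody P) (single L))
       (cong (λ ts' → bindAll (map _† Δ) ts' kL) (trans (map-values Δ (sub (single L)) (λ x → wk (g x))) (values-cong Δ (λ x → sub-single-wk L (g x)))))))
    (bindAll-cong≈ (map _† Δ) _ (λ s Ws → begin
       app (sub (env→sub Ws) P) (sub s L)                   ≈⟨ appL≈ (sub≈ (env→sub Ws) P≈U) ⟩
       app (sub (env→sub Ws) (return U)) (sub s L)          ≡⟨ cong (λ P' → app P' (sub s L)) (sub-return (env→sub Ws) U) ⟩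
       app (return (sub (env→sub Ws) U)) (sub s L)          ≈⟨ return-app _ _ ⟩
       app (sub s L) (sub (env→sub Ws) U)                   ≈⟨ β≈ ⟩
       _                                                    ≡⟨ bindAll-tail-[] ts k n s (sub (env→sub Ws) U) ⟩
       bindAll Bs (All.map (sub s) ts) _                    ≡⟨ bindAll-cong Bs _ (λ s' Ws' → cong (λ U' → k _ (U' ∷ Ws'))
                                                                 (trans (sub-sub s' (env→sub Ws) U) (sub-cong (λ x → sym (env→sub-map (sub s') Ws x)) U))) ⟩
       bindAll Bs (All.map (sub s) ts) _                    ∎)))
    where
    open ≈-Reasoning
    L = lam (bindAll Bs (All.map wk ts) (λ s Ws → k (λ x → s (su x)) (s ze ∷ Ws)))
    kL : Cont Ξ (map _† Δ)
    kL s Ws = kBody P (λ x → sub s (single L x)) Ws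

  bindAll-boxT : ∀ {Ξ ρ Bs} (Δ : Ctx A) (ts₀ : Comps Ξ (map □† Δ)) (B : Tm (map K Δ) (K ρ)) (ts : Comps Ξ Bs)
    (k : Cont Ξ (□† ρ ∷ Bs)) → Natural k →
    bindAll (□† ρ ∷ Bs) (boxT Δ ts₀ B ∷ ts) k ≈
    bindAll (map □† Δ) ts₀ (λ s Ws → bindAll Bs (All.map (sub s) ts) (λ s' Ws' → k (λ x → sub s' (s x)) (box (toArgs Δ (All.map (sub s') Ws)) B ∷ Ws')))
  bindAll-boxT {Ξ} {ρ} {Bs} Δ ts₀ B ts k n =
    ≈-trans β≈
    (≈-trans (≡⇒≈ (trans (sub-bindAll (map □† Δ) _ (kBox Δ B) (natural-kBox Δ B) (single L))
       (cong (λ ts' → bindAll (map □† Δ) ts' kL) (trans (map-fuse (sub-single-wk L) ts₀) (map-id ts₀)))))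
    (bindAll-cong≈ (map □† Δ) _ (λ s Ws →
       ≈-trans β≈ (≡⇒≈ (trans (bindAll-tail-[] ts k n s (box (toArgs Δ Ws) B))
         (bindAll-cong Bs _ (λ s' Ws' → cong (λ Ns → k _ (box Ns B ∷ Ws')) (subA-toArgs Δ s' Ws))))))))
    where
    L = lam (bindAll Bs (All.map wk ts) (λ s Ws → k (λ x → s (su x)) (s ze ∷ Ws)))
    kL : Cont Ξ (map □† Δ)
    kL s Ws = kBox Δ B (λ x → sub s (single L x)) Ws

  -- Box bodies under the □□ substitution

  var†-raise : ∀ (Δ : Ctx A) {X : Ctx A} {a} (x : X ∋ a) → var† (raise Δ x) ≡ raiseᵐ _† Δ (var† x)
  var†-raise []      x = refl
  var†-raise (b ∷ Δ) x = cong su (var†-raise Δ x)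

  var†-injL : ∀ {Δ X : Ctx A} {a} (x : Δ ∋ a) → var† (injL {Θ = X} x) ≡ injLᵐ _† Δ (var† x)
  var†-injL ze     = refl
  var†-injL (su x) = cong su (var†-injL x)

  boxSub† : (Δw : Ctx A) {ρ : Ty A} {Δy Δz : Ctx A} → Tm (ctx† Δy) (ρ †) → Sub (ctx† (Δw ++ ρ ∷ Δz)) (ctx† (Δw ++ Δy ++ Δz))
  boxSub† []       {Δy = Δy} U ze     = ren (injLᵐ _† Δy) U
  boxSub† []       {Δy = Δy} U (su x) = var (raiseᵐ _† Δy x)
  boxSub† (a ∷ Δw) U ze     = var ze
  boxSub† (a ∷ Δw) U (su x) = wk (boxSub† Δw U x)

  boxSub-tracks : ∀ (Δw : Ctx A) {ρ Δy Δz} {V : S.Tm Δy ρ} {U : Tm (ctx† Δy) (ρ †)} → ⟦ V ⟧ ≈ return U →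
                  TracksSub (S.boxSub Δw {Δz = Δz} V) (boxSub† Δw U)
  boxSub-tracks [] {Δy = Δy} {V = V} {U} ⟦V⟧≈U ze =
    ≈-trans (≡⇒≈ (⟦⟧-ren (λ x → sym (var†-injL x)) V)) (≈-trans (ren≈ _ ⟦V⟧≈U) (≡⇒≈ (ren-return _ U)))
  boxSub-tracks [] {Δy = Δy} ⟦V⟧≈U (su x)       = ≡⇒≈ (cong (λ y → return (var y)) (var†-raise Δy x))
  boxSub-tracks (a ∷ Δw) ⟦V⟧≈U ze     = ≈-refl
  boxSub-tracks (a ∷ Δw) ⟦V⟧≈U (su x) =
    ≈-trans (≡⇒≈ (⟦⟧-wk _)) (≈-trans (ren≈ su (boxSub-tracks Δw ⟦V⟧≈U x)) (≡⇒≈ (ren-return su _)))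

  env→sub-injLᵐ : ∀ {Θ} (f : Ty A → Ty A) (Δ : Ctx A) {X} (Us : All (Tm Θ) (map f Δ)) (Ws : All (Tm Θ) (map f X)) {c} (x : map f Δ ∋ c) →
                  env→sub (appendAll f Δ Us Ws) (injLᵐ f Δ x) ≡ env→sub Us x
  env→sub-injLᵐ f (d ∷ Δ) (U ∷ Us) Ws ze     = refl
  env→sub-injLᵐ f (d ∷ Δ) (U ∷ Us) Ws (su x) = env→sub-injLᵐ f Δ Us Ws x

  env→sub-raiseᵐ : ∀ {Θ} (f : Ty A → Ty A) (Δ : Ctx A) {X} (Us : All (Tm Θ) (map f Δ)) (Ws : All (Tm Θ) (map f X)) {c} (x : map f X ∋ c) →
                   env→sub (appendAll f Δ Us Ws) (raiseᵐ f Δ x) ≡ env→sub Ws x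
  env→sub-raiseᵐ f []      []       Ws x = refl
  env→sub-raiseᵐ f (d ∷ Δ) (U ∷ Us) Ws x = env→sub-raiseᵐ f Δ Us Ws x

  env→sub-boxSub† : ∀ (Δw : Ctx A) {ρ Δy Δz Θ} (U : Tm (ctx† Δy) (ρ †))
                    (Ws : All (Tm Θ) (map _† Δw)) (Ys : All (Tm Θ) (map _† Δy)) (Zs : All (Tm Θ) (map _† Δz)) →
                    (λ {τ} x → sub (env→sub (appendAll _† Δw Ws (appendAll _† Δy Ys Zs))) (boxSub† Δw U x))
                    ≗s env→sub (appendAll _† Δw Ws (sub (env→sub Ys) U ∷ Zs))
  env→sub-boxSub† []       {Δy = Δy} U [] Ys Zs ze     =
    trans (sub-ren _ (injLᵐ _† Δy) U) (sub-cong (λ y → env→sub-injLᵐ _† Δy Ys Zs y) U)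
  env→sub-boxSub† []       {Δy = Δy} U [] Ys Zs (su y) = env→sub-raiseᵐ _† Δy Ys Zs y
  env→sub-boxSub† (d ∷ Δw) U (W ∷ Ws) Ys Zs ze     = refl
  env→sub-boxSub† (d ∷ Δw) U (W ∷ Ws) Ys Zs (su y) = trans (sub-ren _ su (boxSub† Δw U y)) (env→sub-boxSub† Δw U Ws Ys Zs y)

  module BoxBoxBody (Δw Δy Δz : Ctx A) (ρ : Ty A) {τ : Ty A} {V : S.Tm Δy ρ} {U : Tm (ctx† Δy) (ρ †)} (⟦V⟧≈U : ⟦ V ⟧ ≈ return U)
                    (M : S.Tm (Δw ++ ρ ∷ Δz) τ) where
    open BoxBox Δw Δy Δz ρ

    private
      M' : S.Tm Ω' τ
      M' = S.sub (S.boxSub Δw V) M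
      B : Tm (map K Δy) (K ρ)
      B = boxBody Δy ⟦ V ⟧ var
      Ξ₀ : Ctx A
      Ξ₀ = (τ † ⇒ atom R) ∷ map K Ω'

      Ws₀ : Comps Ξ₀ (map _† Δw)
      Ws₀ = values Δw (λ x → var (su (injLᵐ K Δw x)))
      gY : Sub (map K Δy) Ξ₀
      gY y = var (su (raiseᵐ K Δw (injLᵐ K Δy y)))
      Ys₀ : Comps Ξ₀ (map _† Δy)
      Ys₀ = values Δy gY
      Zs₀ : Comps Ξ₀ (map _† Δz)
      Zs₀ = values Δz (λ z → var (su (raiseᵐ K Δw (raiseᵐ K Δy z))))

      kInner : ∀ {Θ} (Ψ : Ctx A) (P : Tm (ctx† (Δw ++ Ψ)) (K τ)) → Sub Ξ₀ Θ → All (Tm Θ) (map _† Δw) → Cont Θ (map _† Ψ)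
      kInner Ψ P s Ws s' Ws' = kBody {Δ = Δw ++ Ψ} P (λ x → sub s' (s x)) (appendAll _† Δw (All.map (sub s') Ws) Ws')

      kL : Cont Ξ₀ (map _† Δw)
      kL s Ws = bindAll (map _† (ρ ∷ Δz)) (All.map (sub s) (boxBody Δy ⟦ V ⟧ gY ∷ Zs₀)) (kInner (ρ ∷ Δz) ⟦ M ⟧ s Ws)

      kR : Cont Ξ₀ (map _† Δw)
      kR s Ws = bindAll (map _† (Δy ++ Δz)) (All.map (sub s) (appendAll _† Δy Ys₀ Zs₀)) (kInner (Δy ++ Δz) ⟦ M' ⟧ s Ws)

      lhs≡ : sub (boxSubK B) (boxBody Ω ⟦ M ⟧ var) ≡ lam (bindAll (map _† Δw) Ws₀ kL)
      lhs≡ = trans (sub-boxBody Ω ⟦ M ⟧ var (boxSubK B))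
        (cong lam (trans (cong (λ ts → bindAll (map _† Ω) ts (kBody ⟦ M ⟧)) values≡)
                         (bindAll-++ _† Δw (ρ ∷ Δz) Ws₀ (boxBody Δy ⟦ V ⟧ gY ∷ Zs₀) (kBody ⟦ M ⟧))))
        where
        hole≡ : wk (boxSubK B (raiseᵐ K Δw ze)) ≡ boxBody Δy ⟦ V ⟧ gY
        hole≡ = trans (cong wk (boxSubK-hole B)) (trans (ren-ren su _ B) (trans (ren≡sub _ B) (sub-boxBody Δy ⟦ V ⟧ var _)))
        values≡ : values Ω (λ x → wk (boxSubK B x)) ≡ appendAll _† Δw Ws₀ (boxBody Δy ⟦ V ⟧ gY ∷ Zs₀)
        values≡ = trans (values-++ Δw (ρ ∷ Δz) _) (cong₂ (appendAll _† Δw)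
          (values-cong Δw (λ x → cong wk (boxSubK-left B x)))
          (cong₂ _∷_ hole≡ (values-cong Δz (λ z → cong wk (boxSubK-right B z)))))

      rhs≡ : boxBody Ω' ⟦ M' ⟧ var ≡ lam (bindAll (map _† Δw) Ws₀ kR)
      rhs≡ = cong lam (trans (cong (λ ts → bindAll (map _† Ω') ts (kBody ⟦ M' ⟧))
                                (trans (values-++ Δw (Δy ++ Δz) _) (cong (appendAll _† Δw Ws₀) (values-++ Δy Δz _))))
                             (bindAll-++ _† Δw (Δy ++ Δz) Ws₀ (appendAll _† Δy Ys₀ Zs₀) (kBody ⟦ M' ⟧)))

      ⟦M'⟧≈ : ⟦ M' ⟧ ≈ sub (boxSub† Δw U) ⟦ M ⟧
      ⟦M'⟧≈ = ⟦⟧-sub (boxSub-tracks Δw ⟦V⟧≈U) M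

      kYL kYR : ∀ {Θ} → Sub Ξ₀ Θ → All (Tm Θ) (map _† Δw) → Cont Θ (map _† Δy)
      kYL s Ws s₂ Ys = bindAll (map _† Δz) (All.map (sub s₂) (All.map (sub s) Zs₀))
        (λ s₃ Zs → kInner (ρ ∷ Δz) ⟦ M ⟧ s Ws (λ x → sub s₃ (s₂ x)) (sub (env→sub (All.map (sub s₃) Ys)) U ∷ Zs))
      kYR s Ws s₂ Ys = bindAll (map _† Δz) (All.map (sub s₂) (All.map (sub s) Zs₀))
        (λ s₃ Zs → kInner (Δy ++ Δz) ⟦ M' ⟧ s Ws (λ x → sub s₃ (s₂ x)) (appendAll _† Δy (All.map (sub s₃) Ys) Zs))

      kYL≈kYR : ∀ {Θ Θ₂} (s : Sub Ξ₀ Θ) Ws (s₂ : Sub Θ Θ₂) Ys → kYL s Ws s₂ Ys ≈ kYR s Ws s₂ Ys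
      kYL≈kYR s Ws s₂ Ys = bindAll-cong≈ (map _† Δz) _ (λ s₃ Zs → appL≈ (≈-sym (begin
        sub (env→sub (appendAll _† Δw (All.map (sub (λ x → sub s₃ (s₂ x))) Ws) (appendAll _† Δy (All.map (sub s₃) Ys) Zs))) ⟦ M' ⟧
          ≈⟨ sub≈ _ ⟦M'⟧≈ ⟩
        sub (env→sub (appendAll _† Δw (All.map (sub (λ x → sub s₃ (s₂ x))) Ws) (appendAll _† Δy (All.map (sub s₃) Ys) Zs))) (sub (boxSub† Δw U) ⟦ M ⟧)
          ≡⟨ sub-sub _ (boxSub† Δw U) ⟦ M ⟧ ⟩
        _
          ≡⟨ sub-cong (env→sub-boxSub† Δw U _ (All.map (sub s₃) Ys) Zs) ⟦ M ⟧ ⟩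
        sub (env→sub (appendAll _† Δw (All.map (sub (λ x → sub s₃ (s₂ x))) Ws) (sub (env→sub (All.map (sub s₃) Ys)) U ∷ Zs))) ⟦ M ⟧ ∎)))
        where open ≈-Reasoning

      kL≈kR : ∀ {Θ} (s : Sub Ξ₀ Θ) (Ws : All (Tm Θ) (map _† Δw)) → kL s Ws ≈ kR s Ws
      kL≈kR s Ws = begin
        kL s Ws
          ≡⟨ cong (λ b → bindAll (map _† (ρ ∷ Δz)) (b ∷ All.map (sub s) Zs₀) (kInner (ρ ∷ Δz) ⟦ M ⟧ s Ws)) (sub-boxBody Δy ⟦ V ⟧ gY s) ⟩
        bindAll (map _† (ρ ∷ Δz)) (boxBody Δy ⟦ V ⟧ (λ y → sub s (gY y)) ∷ All.map (sub s) Zs₀) (kInner (ρ ∷ Δz) ⟦ M ⟧ s Ws)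
          ≈⟨ bindAll-boxBody Δy ⟦ V ⟧ U ⟦V⟧≈U _ (All.map (sub s) Zs₀) _ (natural-++ _† Δw (ρ ∷ Δz) (natural-kBody ⟦ M ⟧) s Ws) ⟩
        bindAll (map _† Δy) (values Δy (λ y → sub s (gY y))) (kYL s Ws)
          ≈⟨ bindAll-cong≈ (map _† Δy) _ (kYL≈kYR s Ws) ⟩
        bindAll (map _† Δy) (values Δy (λ y → sub s (gY y))) (kYR s Ws)
          ≡⟨ cong (λ ts → bindAll (map _† Δy) ts (kYR s Ws)) (map-values Δy (sub s) gY) ⟨
        bindAll (map _† Δy) (All.map (sub s) Ys₀) (kYR s Ws)
          ≡⟨ bindAll-++ _† Δy Δz (All.map (sub s) Ys₀) (All.map (sub s) Zs₀) (kInner (Δy ++ Δz) ⟦ M' ⟧ s Ws) ⟨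
        bindAll (map _† (Δy ++ Δz)) (appendAll _† Δy (All.map (sub s) Ys₀) (All.map (sub s) Zs₀)) (kInner (Δy ++ Δz) ⟦ M' ⟧ s Ws)
          ≡⟨ cong (λ ts → bindAll (map _† (Δy ++ Δz)) ts (kInner (Δy ++ Δz) ⟦ M' ⟧ s Ws)) (map-appendAll _† (sub s) Δy Ys₀ Zs₀) ⟨
        kR s Ws ∎
        where open ≈-Reasoning

    boxBody-boxSub : sub (boxSubK B) (boxBody Ω ⟦ M ⟧ var) ≈ boxBody Ω' ⟦ M' ⟧ var
    boxBody-boxSub = ≈-trans (≡⇒≈ lhs≡) (≈-trans (lam≈ (bindAll-cong≈ (map _† Δw) Ws₀ kL≈kR)) (≡⇒≈ (sym rhs≡)))

  -- The □ rules and soundness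

  ⟦□□⟧ : ∀ {Γ Δw Δy Δz ρ τ} {Ws : S.Args Γ Δw} (Ns : S.Args Γ Δy) {V : S.Tm Δy ρ} (Ps : S.Args Γ Δz) (M : S.Tm (Δw ++ ρ ∷ Δz) τ) →
         S.ValArgs Ws → S.Value V →
         ⟦ S.box (Ws S.++ᵃ (S.box Ns V S.∷ Ps)) M ⟧ ≈ ⟦ S.box (Ws S.++ᵃ (Ns S.++ᵃ Ps)) (S.sub (S.boxSub Δw V) M) ⟧
  ⟦□□⟧ {Γ} {Δw} {Δy} {Δz} {ρ} {τ} {Ws} Ns {V} Ps M vWs vV with ⟦⟧ᵃ-values vWs | ⟦⟧-value vV
  ... | Us , ⟦Ws⟧≈Us | U , ⟦V⟧≈U = ≈-trans lhs≈ (≈-trans (lam≈ (bindAll-cong≈ (map □† Δy) _ kL≈kR)) (≈-sym rhs≈))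
    where
    open BoxBox Δw Δy Δz ρ
    M' = S.sub (S.boxSub Δw V) M
    BV = boxBody Δy ⟦ V ⟧ var
    BM = boxBody Ω ⟦ M ⟧ var
    BM' = boxBody Ω' ⟦ M' ⟧ var
    Ξ₀ = □† τ ⇒ atom R ∷ ctx† Γ
    ⟦Ns⟧ = All.map wk ⟦ Ns ⟧ᵃ
    ⟦Ps⟧ = All.map wk ⟦ Ps ⟧ᵃ
    kFrame' : Cont Ξ₀ (map □† (Δy ++ Δz))
    kFrame' = PrefixCont □† Δw (Δy ++ Δz) (kBox Ω' BM') (All.map wk Us)
    kL kR : Cont Ξ₀ (map □† Δy)
    kL s Ys = bindAll (map □† Δz) (All.map (sub s) ⟦Ps⟧)
      (λ s' Zs → kBoxFrame Δw Δz M Us (λ x → sub s' (s x)) (box (toArgs Δy (All.map (sub s') Ys)) BV ∷ Zs))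
    kR s Ys = bindAll (map □† Δz) (All.map (sub s) ⟦Ps⟧)
      (λ s' Zs → kFrame' (λ x → sub s' (s x)) (appendAll □† Δy (All.map (sub s') Ys) Zs))
    kL≈kR : ∀ {Θ} (s : Sub Ξ₀ Θ) Ys → kL s Ys ≈ kR s Ys
    kL≈kR s Ys = bindAll-cong≈ (map □† Δz) _ (λ s' Zs →
      appR≈ (≈-trans (⟶⇒≈ (□□-toArgs _ (All.map (sub s') Ys) Zs BV BM)) (boxB≈ (BoxBoxBody.boxBody-boxSub Δw Δy Δz ρ ⟦V⟧≈U M))))
    lhs≈ : ⟦ S.box (Ws S.++ᵃ (S.box Ns V S.∷ Ps)) M ⟧ ≈ lam (bindAll (map □† Δy) ⟦Ns⟧ kL)
    lhs≈ = begin
      ⟦ S.box (Ws S.++ᵃ (S.box Ns V S.∷ Ps)) M ⟧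
        ≡⟨ trans (⟦box⟧ _ M) (cong (λ ts → lam (bindAll (map □† Ω) ts (kBox Ω BM)))
             (trans (cong (All.map wk) (⟦++ᵃ⟧ Ws (S.box Ns V S.∷ Ps))) (map-appendAll □† wk Δw _ _))) ⟩
      lam (bindAll (map □† Ω) (appendAll □† Δw (All.map wk ⟦ Ws ⟧ᵃ) (wk ⟦ S.box Ns V ⟧ ∷ ⟦Ps⟧)) (kBox Ω BM))
        ≈⟨ lam≈ (bindAll-returns-prefix □† Δw (ρ ∷ Δz) _ (kBox Ω BM) (natural-kBox Ω BM) (≈return*-ren su ⟦Ws⟧≈Us)) ⟩
      lam (bindAll (map □† (ρ ∷ Δz)) (wk ⟦ S.box Ns V ⟧ ∷ ⟦Ps⟧) (kBoxFrame Δw Δz M Us))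
        ≡⟨ cong (λ b → lam (bindAll (map □† (ρ ∷ Δz)) (b ∷ ⟦Ps⟧) (kBoxFrame Δw Δz M Us)))
             (trans (cong wk (⟦box⟧ Ns V)) (ren-boxT Δy su ⟦ Ns ⟧ᵃ BV)) ⟩
      lam (bindAll (map □† (ρ ∷ Δz)) (boxT Δy ⟦Ns⟧ BV ∷ ⟦Ps⟧) (kBoxFrame Δw Δz M Us))
        ≈⟨ lam≈ (bindAll-boxT Δy ⟦Ns⟧ BV ⟦Ps⟧ (kBoxFrame Δw Δz M Us) (natural-kBoxFrame Δw Δz M Us)) ⟩
      lam (bindAll (map □† Δy) ⟦Ns⟧ kL) ∎
      where open ≈-Reasoning
    rhs≈ : ⟦ S.box (Ws S.++ᵃ (Ns S.++ᵃ Ps)) M' ⟧ ≈ lam (bindAll (map □† Δy) ⟦Ns⟧ kR)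
    rhs≈ = begin
      ⟦ S.box (Ws S.++ᵃ (Ns S.++ᵃ Ps)) M' ⟧
        ≡⟨ trans (⟦box⟧ _ M') (cong (λ ts → lam (bindAll (map □† Ω') ts (kBox Ω' BM')))
             (trans (cong (All.map wk) (trans (⟦++ᵃ⟧ Ws (Ns S.++ᵃ Ps)) (cong (appendAll □† Δw ⟦ Ws ⟧ᵃ) (⟦++ᵃ⟧ Ns Ps))))
                    (trans (map-appendAll □† wk Δw _ _) (cong (appendAll □† Δw _) (map-appendAll □† wk Δy _ _))))) ⟩
      lam (bindAll (map □† Ω') (appendAll □† Δw (All.map wk ⟦ Ws ⟧ᵃ) (appendAll □† Δy ⟦Ns⟧ ⟦Ps⟧)) (kBox Ω' BM'))
        ≈⟨ lam≈ (bindAll-returns-prefix □† Δw (Δy ++ Δz) _ (kBox Ω' BM') (natural-kBox Ω' BM') (≈return*-ren su ⟦Ws⟧≈Us)) ⟩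
      lam (bindAll (map □† (Δy ++ Δz)) (appendAll □† Δy ⟦Ns⟧ ⟦Ps⟧) kFrame')
        ≡⟨ cong lam (bindAll-++ □† Δy Δz ⟦Ns⟧ ⟦Ps⟧ kFrame') ⟩
      lam (bindAll (map □† Δy) ⟦Ns⟧ kR) ∎
      where open ≈-Reasoning

  ⟦□id⟧ : ∀ {Γ σ} (M : S.Tm Γ (□ σ)) → ⟦ S.box (M S.∷ S.[]) (S.var ze) ⟧ ≈ ⟦ M ⟧
  ⟦□id⟧ M =
    ≈-trans (lam≈ (appR≈ (lam≈ (appR≈ (≈-trans (boxB≈ body≈var) (▷⇒≈ □id))))))
      (≈-trans (lam≈ (appR≈ (η≈ (var ze)))) (η≈ ⟦ M ⟧))
    where
    body≈var : boxBody _ ⟦ S.var ze ⟧ var ≈ var ze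
    body≈var = ≈-trans (lam≈ (appR≈ (lam≈ β≈))) (≈-trans (lam≈ (appR≈ (η≈ (var ze)))) (η≈ (var ze)))

  ⟦⟧-▷v : ∀ {Γ σ} {M N : S.Tm Γ σ} → M S.▷v N → ⟦ M ⟧ ≈ ⟦ N ⟧
  ⟦⟧-▷v (S.idβ {M = M})                         = ⟦idβ⟧ M
  ⟦⟧-▷v (S.βv {M = M} v)                        = ⟦βv⟧ M v
  ⟦⟧-▷v (S.ηv v)                                = ⟦ηv⟧ v
  ⟦⟧-▷v (S.letC {C = C} {M = M} {N = N} vC)     = ⟦letC⟧ C vC M N
  ⟦⟧-▷v (S.letV {C = C} {y = y} {M = M} vC _)   = ⟦letV⟧ C vC y M
  ⟦⟧-▷v (S.letE {E = E} {y = y} {M = M} vE)     = ⟦letE⟧ E vE y M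
  ⟦⟧-▷v (S.□id {M = M})                         = ⟦□id⟧ M
  ⟦⟧-▷v (S.□□ {N = Ns} {P = Ps} {M = M} vWs vV) = ⟦□□⟧ Ns Ps M vWs vV

  module SV = S.Closure S._▷v_

  ⟦⟧-→v  : ∀ {Γ σ} {M N : S.Tm Γ σ} → M SV.⟶ N → ⟦ M ⟧ ≈ ⟦ N ⟧
  ⟦⟧ᵃ-→v : ∀ {Γ Δ} {Ms Ns : S.Args Γ Δ} → Ms SV.⟶ᵃ Ns → ⟦ Ms ⟧ᵃ ≈* ⟦ Ns ⟧ᵃ
  ⟦⟧-→v (SV.base r)                  = ⟦⟧-▷v r
  ⟦⟧-→v (SV.ξlam {M = M} {M'} r)     =
    ≈-trans (≡⇒≈ (⟦lam⟧ M)) (≈-trans (return≈ (lamK≈ (⟦⟧-→v r))) (≡⇒≈ (sym (⟦lam⟧ M'))))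
  ⟦⟧-→v (SV.ξappL r)                 = lam≈ (appL≈ (ren≈ su (⟦⟧-→v r)))
  ⟦⟧-→v (SV.ξappR r)                 = lam≈ (appR≈ (lam≈ (appL≈ (ren≈ su (ren≈ su (⟦⟧-→v r))))))
  ⟦⟧-→v (SV.ξboxA {Δ = Δ} {Ns = Ns} {Ns'} {M = M} r) =
    ≈-trans (≡⇒≈ (⟦box⟧ Ns M)) (≈-trans (boxT≈ Δ _ (⟦⟧ᵃ-→v r)) (≡⇒≈ (sym (⟦box⟧ Ns' M))))
  ⟦⟧-→v (SV.ξboxB {Δ = Δ} {Ns = Ns} {M = M} {M'} r) =
    ≈-trans (≡⇒≈ (⟦box⟧ Ns M)) (≈-trans (lam≈ (bindAll-cong≈ (map □† Δ) _ (λ s Ws → appR≈ (boxB≈ (lam≈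
      (bindAll-cong≈ (map _† Δ) _ (λ s' Ws' → appL≈ (sub≈ (env→sub Ws') (⟦⟧-→v r))))))))) (≡⇒≈ (sym (⟦box⟧ Ns M'))))
  ⟦⟧ᵃ-→v (SV.here {Ns = Ns} r) = ⟦⟧-→v r ∷ ≈*-refl ⟦ Ns ⟧ᵃ
  ⟦⟧ᵃ-→v (SV.there r)          = ≈-refl ∷ ⟦⟧ᵃ-→v r

  ⟦⟧-=v : ∀ {Γ σ} {M N : S.Tm Γ σ} → M S.=v N → ⟦ M ⟧ ≈ ⟦ N ⟧
  ⟦⟧-=v = EQ.gfold (EQ.isEquivalence _) ⟦_⟧ ⟦⟧-→v

theorem3 : {A : Set} (Const : Ty A → Set) (R : A) →
    ∀ {Γ σ} (M N : Calculus.Tm Const Γ σ) →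
    Calculus._=v_ Const M N →
    Calculus._=n_ (CPS.TConst Const R) (CPS.⟦_⟧ Const R M) (CPS.⟦_⟧ Const R N)
theorem3 Const R M N = Soundness.⟦⟧-=v Const R
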